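{- The triple $(\mathrm{cyc},\ \mathrm{st}\circ\mathrm{SOR}\text{ -code},\ \mathrm{sor})$ is Stirling-Euler-Mahonian.
   Context: For a positive integer $n$, $\mathfrak{S}_n$ denotes the set of permutations of $\{1,\dots,n\}$, written as words $\sigma=\sigma_1\cdots\sigma_n$. A descent of $\sigma$ is an index $j\in\{1,\dots,n-1\}$ with $\sigma_j>\sigma_{j+1}$; $\mathrm{des}(\sigma)$ is the number of descents and $\mathrm{maj}(\sigma)$ the sum of the descents. A value $\sigma_j$ is a right-to-left minimum if $\sigma_j<\sigma_k$ for all $k>j$; $\mathrm{rlmin}(\sigma)$ is their number. $\mathrm{cyc}(\sigma)$ is the number of cycles (including fixed points) in the disjoint cycle decomposition of $\sigma$. For $1\le j\le n$, let $C$ be the cycle of $\sigma$ containing $j$: if $j$ is the smallest element of $C$ set $c_j(\sigma)=j$; otherwise let $c_j(\sigma)$ be the element $k<j$ of $C$ reached in the fewest steps when moving from $j$ along $C$ (i.e., the first element less than $j$ in the sequence $\sigma(j),\sigma^2(j),\dots$). Let $s_j(\sigma)=j-c_j(\sigma)$, $\mathrm{sor}(\sigma)=\sum_{j=1}^n s_j(\sigma)$, and $\mathrm{SOR}\text{ -code}(\sigma)=(s_1(\sigma),\dots,s_n(\sigma))$. For an integer tuple $(e_1,\dots,e_n)$, $\mathrm{st}$ is the largest $\ell\ge0$ such that there exist indices $j_1<\cdots<j_\ell$ with $e_{j_k}\ge k$ for $1\le k\le\ell$. A triple of statistics $(S,E,M)$ is Stirling-Euler-Mahonian if for every $n\ge1$,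 $\sum_{\sigma\in\mathfrak{S}_n}y^{S(\sigma)}x^{E(\sigma)}q^{M(\sigma)}=\sum_{\sigma\in\mathfrak{S}_n}y^{\mathrm{rlmin}(\sigma)}x^{\mathrm{des}(\sigma)}q^{\mathrm{maj}(\sigma)}$. -}

module Defs where

open import Data.Nat using (ℕ; zero; suc; _+_; _∸_; _⊔_; _<ᵇ_; _≤ᵇ_; _≡ᵇ_)
open import Data.Bool using (Bool; true; false; if_then_else_; _∧_)
open import Data.Fin using (Fin; toℕ)
import Data.Fin.Properties as FinP using (_≟_)
open import Data.Vec using (Vec; []; _∷_; toList)
open import Data.List using (List; []; _∷_; map; concatMap; filter; length; foldr; allFin; upTo)
open import Data.Nat.ListAction using (sum)
open import Data.Product using (_×_; _,_)
open import Relation.Binary.PropositionalEquality using (_≡_)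

-- The symmetric group 𝔖ₙ, as the list of all words σ₁⋯σₙ over
-- {1,…,n} (encoded as Fin n, value i ↦ toℕ i + 1) with distinct letters.

words : (k n : ℕ) → List (Vec (Fin n) k)
words zero    n = [] ∷ []
words (suc k) n = concatMap (λ i → map (i ∷_) (words k n)) (allFin n)

import Data.List.Relation.Unary.Unique.DecPropositional as UDP
module U (n : ℕ) = UDP (FinP._≟_ {n})

Sym : (n : ℕ) → List (Vec (Fin n) n)
Sym n = filter (λ σ → U.unique? n (toList σ)) (words n n)

word : {n : ℕ} → Vec (Fin n) n → List ℕ
word σ = map (λ i → suc (toℕ i)) (toList σ)

-- w(j) for 1 ≤ j ≤ n (0 outside the range)
nth : List ℕ → ℕ → ℕ
nth []       _       = 0
nth (x ∷ xs) zero    = x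
nth (x ∷ xs) (suc k) = nth xs k

app : List ℕ → ℕ → ℕ
app w j = nth w (j ∸ 1)

iter : List ℕ → ℕ → ℕ → ℕ
iter w zero    j = j
iter w (suc k) j = app w (iter w k j)

allB : {A : Set} → (A → Bool) → List A → Bool
allB p []       = true
allB p (x ∷ xs) = p x ∧ allB p xs

boolFilter : {A : Set} → (A → Bool) → List A → List A
boolFilter p []       = []
boolFilter p (x ∷ xs) = if p x then x ∷ boolFilter p xs else boolFilter p xs

countB : {A : Set} → (A → Bool) → List A → ℕ
countB p xs = length (boolFilter p xs)

descentsFrom : ℕ → List ℕ → List ℕ
descentsFrom i []            = []
descentsFrom i (a ∷ [])      = []
descentsFrom i (a ∷ b ∷ xs)  =
  (if b <ᵇ a then i ∷ [] else []) Data.List.++ descentsFrom (suc i) (b ∷ xs)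

descents : List ℕ → List ℕ
descents = descentsFrom 1

des : {n : ℕ} → Vec (Fin n) n → ℕ
des σ = length (descents (word σ))

maj : {n : ℕ} → Vec (Fin n) n → ℕ
maj σ = sum (descents (word σ))

rlminW : List ℕ → ℕ
rlminW []       = 0
rlminW (a ∷ xs) = (if allB (λ b → a <ᵇ b) xs then 1 else 0) + rlminW xs

rlmin : {n : ℕ} → Vec (Fin n) n → ℕ
rlmin σ = rlminW (word σ)

-- Each cycle is counted once, via its smallest
-- element: j ∈ {1..n} is the smallest element of its cycle iff
-- σᵗ(j) ≥ j for all 1 ≤ t ≤ n (the cycle of j is {σᵗ(j) : 1 ≤ t ≤ n}).

isCycleMin : List ℕ → ℕ → ℕ → Bool
isCycleMin w n j = allB (λ t → j ≤ᵇ iter w t j) (map suc (upTo n))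

cyc : {n : ℕ} → Vec (Fin n) n → ℕ
cyc {n} σ = countB (isCycleMin (word σ) n) (map suc (upTo n))

-- SOR-code and sor.
-- c_j : first element < j in σ(j), σ²(j), …  (searched with fuel;
-- n steps cover the whole cycle of j); if there is none, i.e. j is the
-- smallest element of its cycle, c_j = j.

firstBelow : List ℕ → ℕ → ℕ → ℕ → ℕ
firstBelow w j zero       k = j
firstBelow w j (suc fuel) k =
  let m = app w k in if m <ᵇ j then m else firstBelow w j fuel m

cW : List ℕ → ℕ → ℕ → ℕ
cW w n j = firstBelow w j n j

SORcode : {n : ℕ} → Vec (Fin n) n → List ℕ
SORcode {n} σ = map (λ j → j ∸ cW (word σ) n j) (map suc (upTo n))

sor : {n : ℕ} → Vec (Fin n) n → ℕ
sor σ = sum (SORcode σ)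

-- st (e₁,…,eₙ): largest ℓ such that there are indices j₁<⋯<j_ℓ with
-- e_{j_k} ≥ k. Subsequences of e = choices of increasing indices.

subseqs : List ℕ → List (List ℕ)
subseqs []       = [] ∷ []
subseqs (x ∷ xs) = map (x ∷_) (subseqs xs) Data.List.++ subseqs xs

okFrom : ℕ → List ℕ → Bool
okFrom k []       = true
okFrom k (x ∷ xs) = (k ≤ᵇ x) ∧ okFrom (suc k) xs

st : List ℕ → ℕ
st e = foldr _⊔_ 0 (map length (boolFilter (okFrom 1) (subseqs e)))

-- Joint distribution of a triple of statistics on 𝔖ₙ:
-- number of σ ∈ 𝔖ₙ with (S σ, E σ, M σ) = (a , b , c),
-- i.e. the coefficient of yᵃ xᵇ qᶜ in Σ_σ y^S x^E q^M.

Stat : Set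
Stat = {n : ℕ} → Vec (Fin n) n → ℕ

coeff : (S E M : Stat) → (n a b c : ℕ) → ℕ
coeff S E M n a b c =
  countB (λ σ → (S σ ≡ᵇ a) ∧ (E σ ≡ᵇ b) ∧ (M σ ≡ᵇ c)) (Sym n)

StirlingEulerMahonian : (S E M : Stat) → Set
StirlingEulerMahonian S E M =
  (n : ℕ) → 1 Data.Nat.≤ n → (a b c : ℕ) →
  coeff S E M n a b c ≡ coeff rlmin des maj n a b c

stSOR : Stat
stSOR σ = st (SORcode σ)

-- Both triples are generated by the same branching rule. Every permutation of [1, n+1]
-- arises exactly once from one of [1, n] by inserting n+1 into one of the n+1 slots of
-- its word, and also exactly once by inserting n+1 into its cycles: as a fixed point, or
-- just before some a ≤ n in the cycle of a. Under the second insertion the SOR-code only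
-- gains the last entry v = n+1−a (v = 0 for a fixed point). As cyc counts the zero entries
-- of the code, sor is their sum, and st (e ∷ʳ v) = st e + [st e < v] because st can be
-- computed greedily, the new triple (cyc, st∘SOR-code, sor) depends only on the old one and v.
-- By Carlitz's insertion argument, inserting n+1 into the word changes (rlmin, des, maj) by
-- the same rule: the last slot adds a right-to-left minimum, and the other slots raise maj
-- by 1, …, n, creating a new descent exactly when the raise exceeds des.

module Submission where

open import Defs
open import Data.Bool using (Bool; true; false; if_then_else_; _∧_; T)
open import Data.Bool.Properties using (T-≡)
open import Data.Empty using (⊥-elim)
open import Data.Fin using (Fin; toℕ; fromℕ<)
open import Data.Fin.Properties using (toℕ-injective; toℕ<n; toℕ-fromℕ<; pigeonhole)
open import Data.List
  using (List; []; _∷_; map; concat; concatMap; length; foldr; allFin; upTo; applyUpTo;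
         _++_; [_]; _∷ʳ_; initLast; _∷ʳ′_)
open import Data.List.Properties
  using (map-++; ++-assoc; map-∘; map-id; map-upTo; length-map; length-upTo; ++-identityʳ;
         upTo-∷ʳ; ∷-injective; map-cong-local; ∷ʳ-injective; map-injective; map-concatMap; concatMap-map)
open import Data.List.Membership.Propositional using (_∈_; _∉_; find; lose)
open import Data.List.Membership.Propositional.Properties
open import Data.List.Membership.Propositional.Properties.WithK using (unique∧set⇒bag)
open import Data.List.Relation.Binary.BagAndSetEquality using (∼bag⇒↭)
open import Data.List.Relation.Binary.Permutation.Propositional
  using (_↭_; refl; prep; swap; ↭-refl; ↭-sym; ↭-reflexive; ↭⇒↭ₛ; module PermutationReasoning)
  renaming (trans to ↭-trans)
open import Data.List.Relation.Binary.Permutation.Propositional.Properties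
  using (map⁺; ++⁺; ++⁺ˡ; ++⁺ʳ; ∈-resp-↭; shift; shifts; drop-mid; ∷↭∷ʳ; ↭-length)
import Data.List.Relation.Binary.Permutation.Setoid.Properties as ↭ₛ
open import Data.List.Relation.Unary.All using (All; []; _∷_)
import Data.List.Relation.Unary.All as All
open import Data.List.Relation.Unary.Any using (here; there)
open import Data.List.Relation.Unary.AllPairs using ([]; _∷_)
open import Data.List.Relation.Unary.Unique.Propositional using (Unique)
import Data.List.Relation.Unary.Unique.Propositional.Properties as Unique
open import Data.Nat using (ℕ; zero; suc; pred; _+_; _∸_; _⊔_; _<ᵇ_; _≤ᵇ_; _≡ᵇ_; _≤_; _<_; z≤n; s≤s)
open import Data.Nat.Properties
open import Data.Nat.ListAction using (sum)
open import Data.Nat.ListAction.Properties using (sum-++)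
open import Data.Nat.Tactic.RingSolver using (solve-∀)
open import Data.Product using (_×_; _,_; proj₁; proj₂; Σ)
open import Data.Sum using (_⊎_; inj₁; inj₂)
open import Data.Vec using (Vec; toList) renaming ([] to v[]; _∷_ to _v∷_)
open import Data.Vec.Properties using (length-toList)
open import Function using (_∘_)
open import Function.Bundles using (mk⇔; Equivalence)
open import Relation.Nullary using (¬_)
open import Relation.Binary.PropositionalEquality hiding ([_])

countB-++ : {A : Set} (p : A → Bool) (xs ys : List A) →
            countB p (xs ++ ys) ≡ countB p xs + countB p ys
countB-++ p [] ys = refl
countB-++ p (x ∷ xs) ys with p x
... | true  = cong suc (countB-++ p xs ys)
... | false = countB-++ p xs ys

countB-map : {A B : Set} (p : B → Bool) (f : A → B) (xs : List A) →
             countB (p ∘ f) xs ≡ countB p (map f xs)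
countB-map p f [] = refl
countB-map p f (x ∷ xs) with p (f x)
... | true  = cong suc (countB-map p f xs)
... | false = countB-map p f xs

countB-cong-∈ : {A : Set} (p q : A → Bool) (xs : List A) →
                (∀ {x} → x ∈ xs → p x ≡ q x) → countB p xs ≡ countB q xs
countB-cong-∈ p q [] _ = refl
countB-cong-∈ p q (x ∷ xs) p≡q with p x | q x | p≡q (here refl)
... | true  | .true  | refl = cong suc (countB-cong-∈ p q xs (p≡q ∘ there))
... | false | .false | refl = countB-cong-∈ p q xs (p≡q ∘ there)

countB-resp-↭ : {A : Set} (p : A → Bool) {xs ys : List A} → xs ↭ ys → countB p xs ≡ countB p ys
countB-resp-↭ p refl = refl
countB-resp-↭ p (prep x xs↭ys) with p x
... | true  = cong suc (countB-resp-↭ p xs↭ys)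
... | false = countB-resp-↭ p xs↭ys
countB-resp-↭ p (swap x y xs↭ys) with p x | p y
... | true  | true  = cong (λ k → suc (suc k)) (countB-resp-↭ p xs↭ys)
... | true  | false = cong suc (countB-resp-↭ p xs↭ys)
... | false | true  = cong suc (countB-resp-↭ p xs↭ys)
... | false | false = countB-resp-↭ p xs↭ys
countB-resp-↭ p (↭-trans p₁ p₂) = trans (countB-resp-↭ p p₁) (countB-resp-↭ p p₂)

map-cong-∈ : {A B : Set} (f g : A → B) (xs : List A) →
             (∀ {x} → x ∈ xs → f x ≡ g x) → map f xs ≡ map g xs
map-cong-∈ f g xs f≡g = map-cong-local (All.tabulate f≡g)

concatMap-cong-∈ : {A B : Set} (f g : A → List B) (xs : List A) →
                   (∀ {x} → x ∈ xs → f x ≡ g x) → concatMap f xs ≡ concatMap g xs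
concatMap-cong-∈ f g xs f≡g = cong concat (map-cong-∈ f g xs f≡g)

concatMap-cong-↭ : {A B : Set} (f g : A → List B) (xs : List A) →
                   (∀ {x} → x ∈ xs → f x ↭ g x) → concatMap f xs ↭ concatMap g xs
concatMap-cong-↭ f g [] _ = ↭-refl
concatMap-cong-↭ f g (x ∷ xs) f↭g = ++⁺ (f↭g (here refl)) (concatMap-cong-↭ f g xs (f↭g ∘ there))

concatMap-resp-↭ : {A B : Set} (f : A → List B) {xs ys : List A} → xs ↭ ys → concatMap f xs ↭ concatMap f ys
concatMap-resp-↭ f refl = ↭-refl
concatMap-resp-↭ f (prep x p) = ++⁺ˡ (f x) (concatMap-resp-↭ f p)
concatMap-resp-↭ f (swap x y p) = ↭-trans (shifts (f x) (f y)) (++⁺ˡ (f y) (++⁺ˡ (f x) (concatMap-resp-↭ f p)))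
concatMap-resp-↭ f (↭-trans p q) = ↭-trans (concatMap-resp-↭ f p) (concatMap-resp-↭ f q)

Unique-resp-↭ : {A : Set} {xs ys : List A} → xs ↭ ys → Unique xs → Unique ys
Unique-resp-↭ {A} p = ↭ₛ.Unique-resp-↭ (setoid A) (↭⇒↭ₛ p)

Unique-map-injectiveOn : {A B : Set} (f : A → B) {xs : List A} → Unique xs →
  (∀ {x y} → x ∈ xs → y ∈ xs → f x ≡ f y → x ≡ y) → Unique (map f xs)
Unique-map-injectiveOn f {[]} _ _ = []
Unique-map-injectiveOn f {x ∷ xs} (x∉ ∷ u) inj =
  All.tabulate fx∉ ∷ Unique-map-injectiveOn f u (λ x∈ y∈ → inj (there x∈) (there y∈))
  where
  fx∉ : ∀ {z} → z ∈ map f xs → ¬ f x ≡ z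
  fx∉ z∈ fx≡z with ∈-map⁻ f z∈
  ... | y , y∈ , refl = All.lookup x∉ y∈ (inj (here refl) (there y∈) fx≡z)

Unique-concatMap : {A B : Set} (f : A → List B) {xs : List A} → Unique xs →
  (∀ {x} → x ∈ xs → Unique (f x)) →
  (∀ {x x′ y} → x ∈ xs → x′ ∈ xs → y ∈ f x → y ∈ f x′ → x ≡ x′) →
  Unique (concatMap f xs)
Unique-concatMap f {[]} _ _ _ = []
Unique-concatMap f {x ∷ xs} (x∉ ∷ u) uf disj =
  Unique.++⁺ (uf (here refl)) (Unique-concatMap f u (uf ∘ there) (λ x∈ x′∈ → disj (there x∈) (there x′∈))) apart
  where
  apart : ∀ {y} → ¬ (y ∈ f x × y ∈ concatMap f xs)
  apart (y∈fx , y∈rest) with find (∈-concatMap⁻ f {xs = xs} y∈rest)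
  ... | x′ , x′∈ , y∈fx′ = All.lookup x∉ x′∈ (disj (here refl) (there x′∈) y∈fx y∈fx′)

unique-⊆-⊇⇒↭ : {A : Set} {xs ys : List A} → Unique xs → Unique ys →
  (∀ {x} → x ∈ xs → x ∈ ys) → (∀ {x} → x ∈ ys → x ∈ xs) → xs ↭ ys
unique-⊆-⊇⇒↭ ux uy xs⊆ys ys⊆xs = ∼bag⇒↭ (unique∧set⇒bag ux uy (mk⇔ xs⊆ys ys⊆xs))

module _ {A : Set} {x : A} where

  ∈-++-∷⁻ : ∀ {y} (as bs : List A) → y ∈ as ++ x ∷ bs → y ≡ x ⊎ y ∈ as ++ bs
  ∈-++-∷⁻ [] bs (here y≡x) = inj₁ y≡x
  ∈-++-∷⁻ [] bs (there y∈) = inj₂ y∈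
  ∈-++-∷⁻ (a ∷ as) bs (here y≡a) = inj₂ (here y≡a)
  ∈-++-∷⁻ (a ∷ as) bs (there y∈) with ∈-++-∷⁻ as bs y∈
  ... | inj₁ y≡x = inj₁ y≡x
  ... | inj₂ y∈′ = inj₂ (there y∈′)

  length-++-∷ : (as bs : List A) → length (as ++ x ∷ bs) ≡ suc (length (as ++ bs))
  length-++-∷ [] bs = refl
  length-++-∷ (a ∷ as) bs = cong suc (length-++-∷ as bs)

unique-⊆-length⇒⊇ : {A : Set} {xs ys : List A} → Unique xs → (∀ {x} → x ∈ xs → x ∈ ys) →
  length ys ≤ length xs → ∀ {y} → y ∈ ys → y ∈ xs
unique-⊆-length⇒⊇ {xs = []} {[]} _ _ _ ()
unique-⊆-length⇒⊇ {xs = x ∷ xs} (x∉ ∷ u) xs⊆ys len {y} y∈ with ∈-∃++ (xs⊆ys (here refl))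
... | as , bs , refl with ∈-++-∷⁻ as bs y∈
... | inj₁ y≡x = here y≡x
... | inj₂ y∈′ = there (unique-⊆-length⇒⊇ u xs⊆as++bs len′ y∈′)
  where
  xs⊆as++bs : ∀ {z} → z ∈ xs → z ∈ as ++ bs
  xs⊆as++bs z∈ with ∈-++-∷⁻ as bs (xs⊆ys (there z∈))
  ... | inj₁ z≡x = ⊥-elim (All.lookup x∉ z∈ (sym z≡x))
  ... | inj₂ z∈′ = z∈′
  len′ : length (as ++ bs) ≤ length xs
  len′ = ≤-pred (subst (_≤ suc (length xs)) (length-++-∷ as bs) len)

≡ᵇ-true⇒≡ : ∀ {m n} → (m ≡ᵇ n) ≡ true → m ≡ n
≡ᵇ-true⇒≡ {m} {n} e = ≡ᵇ⇒≡ m n (subst T (sym e) _)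

≡ᵇ-refl : ∀ m → (m ≡ᵇ m) ≡ true
≡ᵇ-refl m = Equivalence.to T-≡ (≡⇒≡ᵇ m m refl)

≡ᵇ-false⇒≢ : ∀ {m n} → (m ≡ᵇ n) ≡ false → m ≢ n
≡ᵇ-false⇒≢ {m} e refl with trans (sym e) (≡ᵇ-refl m)
... | ()

≢⇒≡ᵇ-false : ∀ {m n} → m ≢ n → (m ≡ᵇ n) ≡ false
≢⇒≡ᵇ-false {m} {n} m≢n with m ≡ᵇ n in e
... | true  = ⊥-elim (m≢n (≡ᵇ-true⇒≡ e))
... | false = refl

<ᵇ-true⇒< : ∀ {m n} → (m <ᵇ n) ≡ true → m < n
<ᵇ-true⇒< {m} {n} e = <ᵇ⇒< m n (subst T (sym e) _)

<ᵇ-false⇒≥ : ∀ {m n} → (m <ᵇ n) ≡ false → n ≤ m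
<ᵇ-false⇒≥ e = ≮⇒≥ (λ m<n → subst T e (<⇒<ᵇ m<n))

<⇒<ᵇ-true : ∀ {m n} → m < n → (m <ᵇ n) ≡ true
<⇒<ᵇ-true m<n = Equivalence.to T-≡ (<⇒<ᵇ m<n)

≥⇒<ᵇ-false : ∀ {m n} → n ≤ m → (m <ᵇ n) ≡ false
≥⇒<ᵇ-false {m} {n} n≤m with m <ᵇ n in e
... | true  = ⊥-elim (≤⇒≯ n≤m (<ᵇ-true⇒< e))
... | false = refl

≤⇒≤ᵇ-true : ∀ {m n} → m ≤ n → (m ≤ᵇ n) ≡ true
≤⇒≤ᵇ-true m≤n = Equivalence.to T-≡ (≤⇒≤ᵇ m≤n)

>⇒≤ᵇ-false : ∀ {m n} → n < m → (m ≤ᵇ n) ≡ false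
>⇒≤ᵇ-false {suc m} (s≤s n≤m) = ≥⇒<ᵇ-false n≤m

-- Permutations of [1, n] as words

oneTo : ℕ → List ℕ
oneTo n = map suc (upTo n)

oneTo-suc : ∀ n → oneTo (suc n) ≡ oneTo n ∷ʳ suc n
oneTo-suc n = trans (cong (map suc) (sym (upTo-∷ʳ n))) (map-++ suc (upTo n) [ n ])

Unique-oneTo : ∀ n → Unique (oneTo n)
Unique-oneTo n = Unique.map⁺ suc-injective (Unique.upTo⁺ n)

length-oneTo : ∀ n → length (oneTo n) ≡ n
length-oneTo n = trans (length-map suc (upTo n)) (length-upTo n)

InRange : ℕ → ℕ → Set
InRange n x = 1 ≤ x × x ≤ n

∈-oneTo⁻ : ∀ n {x} → x ∈ oneTo n → InRange n x
∈-oneTo⁻ n x∈ with ∈-map⁻ suc x∈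
... | y , y∈ , refl = s≤s z≤n , ∈-upTo⁻ y∈

∈-oneTo⁺ : ∀ n {x} → InRange n x → x ∈ oneTo n
∈-oneTo⁺ n {suc x} (_ , x<n) = ∈-map⁺ suc (∈-upTo⁺ x<n)

suc∉oneTo : ∀ n → suc n ∉ oneTo n
suc∉oneTo n sn∈ = <-irrefl refl (proj₂ (∈-oneTo⁻ n sn∈))

oneTo-suc-split : ∀ n {as bs} → as ++ suc n ∷ bs ↭ oneTo (suc n) → as ++ bs ↭ oneTo n
oneTo-suc-split n {as} p =
  ↭-trans (drop-mid as (oneTo n) (↭-trans p (↭-reflexive (oneTo-suc n)))) (↭-reflexive (++-identityʳ (oneTo n)))

insertions : ℕ → List ℕ → List (List ℕ)
insertions M [] = [ M ] ∷ []
insertions M (a ∷ w) = (M ∷ a ∷ w) ∷ map (a ∷_) (insertions M w)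

perms : ℕ → List (List ℕ)
perms zero = [] ∷ []
perms (suc n) = concatMap (insertions (suc n)) (perms n)

insertions-↭ : ∀ M w {y} → y ∈ insertions M w → y ↭ M ∷ w
insertions-↭ M [] (here refl) = ↭-refl
insertions-↭ M (a ∷ w) (here refl) = ↭-refl
insertions-↭ M (a ∷ w) (there y∈) with ∈-map⁻ (a ∷_) y∈
... | y′ , y′∈ , refl = ↭-trans (prep a (insertions-↭ M w y′∈)) (swap a M ↭-refl)

∈-insertions : ∀ M as bs → as ++ M ∷ bs ∈ insertions M (as ++ bs)
∈-insertions M [] [] = here refl
∈-insertions M [] (b ∷ bs) = here refl
∈-insertions M (a ∷ as) bs = there (∈-map⁺ (a ∷_) (∈-insertions M as bs))

delete : ℕ → List ℕ → List ℕ
delete M [] = []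
delete M (x ∷ xs) = if x ≡ᵇ M then xs else x ∷ delete M xs

delete-insertions : ∀ M w {y} → M ∉ w → y ∈ insertions M w → delete M y ≡ w
delete-insertions M [] _ (here refl) rewrite ≡ᵇ-refl M = refl
delete-insertions M (a ∷ w) _ (here refl) rewrite ≡ᵇ-refl M = refl
delete-insertions M (a ∷ w) M∉ (there y∈) with ∈-map⁻ (a ∷_) y∈
... | y′ , y′∈ , refl rewrite ≢⇒≡ᵇ-false (λ a≡M → M∉ (here (sym a≡M))) =
  cong (a ∷_) (delete-insertions M w (M∉ ∘ there) y′∈)

Unique-insertions : ∀ M w → M ∉ w → Unique (insertions M w)
Unique-insertions M [] _ = [] ∷ []
Unique-insertions M (a ∷ w) M∉ =
  All.tabulate head∉ ∷ Unique.map⁺ (proj₂ ∘ ∷-injective) (Unique-insertions M w (M∉ ∘ there))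
  where
  head∉ : ∀ {y} → y ∈ map (a ∷_) (insertions M w) → ¬ M ∷ a ∷ w ≡ y
  head∉ y∈ eq with ∈-map⁻ (a ∷_) y∈
  ... | _ , _ , refl = M∉ (here (proj₁ (∷-injective eq)))

perms-sound : ∀ n {w} → w ∈ perms n → w ↭ oneTo n
perms-sound zero (here refl) = ↭-refl
perms-sound (suc n) w∈ with find (∈-concatMap⁻ (insertions (suc n)) {xs = perms n} w∈)
... | w′ , w′∈ , w∈′ = begin
  _                     ↭⟨ insertions-↭ (suc n) w′ w∈′ ⟩
  suc n ∷ w′            ↭⟨ ∷↭∷ʳ (suc n) w′ ⟩
  w′ ∷ʳ suc n           ↭⟨ ++⁺ʳ [ suc n ] (perms-sound n w′∈) ⟩
  oneTo n ∷ʳ suc n      ≡⟨ oneTo-suc n ⟨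
  oneTo (suc n)         ∎
  where open PermutationReasoning

perms-complete : ∀ n {w} → w ↭ oneTo n → w ∈ perms n
perms-complete zero {[]} _ = here refl
perms-complete zero {_ ∷ _} p with ↭-length p
... | ()
perms-complete (suc n) {w} p with ∈-∃++ (∈-resp-↭ (↭-sym p) (∈-oneTo⁺ (suc n) (s≤s z≤n , ≤-refl)))
... | as , bs , refl = ∈-concatMap⁺ (insertions (suc n)) {xs = perms n}
  (lose (perms-complete n (oneTo-suc-split n p)) (∈-insertions (suc n) as bs))

perms-suc∉ : ∀ n {w} → w ∈ perms n → suc n ∉ w
perms-suc∉ n w∈ sn∈ = suc∉oneTo n (∈-resp-↭ (perms-sound n w∈) sn∈)

Unique-perms : ∀ n → Unique (perms n)
Unique-perms zero = [] ∷ []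
Unique-perms (suc n) = Unique-concatMap (insertions (suc n)) (Unique-perms n)
  (λ w∈ → Unique-insertions (suc n) _ (perms-suc∉ n w∈))
  (λ w∈ w′∈ y∈ y∈′ → trans (sym (delete-insertions (suc n) _ (perms-suc∉ n w∈) y∈))
                           (delete-insertions (suc n) _ (perms-suc∉ n w′∈) y∈′))

toList-injective : {A : Set} {k : ℕ} {u v : Vec A k} → toList u ≡ toList v → u ≡ v
toList-injective {u = v[]} {v[]} _ = refl
toList-injective {u = x v∷ u} {y v∷ v} eq =
  cong₂ _v∷_ (proj₁ (∷-injective eq)) (toList-injective (proj₂ (∷-injective eq)))

word-injective : {n : ℕ} {u v : Vec (Fin n) n} → word u ≡ word v → u ≡ v
word-injective = toList-injective ∘ map-injective (toℕ-injective ∘ suc-injective)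

word-length : {n : ℕ} (σ : Vec (Fin n) n) → length (word σ) ≡ n
word-length σ = trans (length-map _ (toList σ)) (length-toList σ)

∈-word⁻ : {n : ℕ} (σ : Vec (Fin n) n) {x : ℕ} → x ∈ word σ → x ∈ oneTo n
∈-word⁻ {n} σ x∈ with ∈-map⁻ _ x∈
... | i , _ , refl = ∈-oneTo⁺ n (s≤s z≤n , toℕ<n i)

∈-words : (k n : ℕ) (v : Vec (Fin n) k) → v ∈ words k n
∈-words zero n v[] = here refl
∈-words (suc k) n (i v∷ v) = ∈-concatMap⁺ (λ i → map (i v∷_) (words k n)) {xs = allFin n}
  (lose (∈-allFin i) (∈-map⁺ (i v∷_) (∈-words k n v)))

Unique-words : (k n : ℕ) → Unique (words k n)
Unique-words zero n = [] ∷ []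
Unique-words (suc k) n = Unique-concatMap (λ i → map (i v∷_) (words k n)) (Unique.allFin⁺ n)
  (λ _ → Unique.map⁺ tail-injective (Unique-words k n))
  (λ _ _ y∈ y∈′ → trans (sym (head-of y∈)) (head-of y∈′))
  where
  tail-injective : {i : Fin n} {u v : Vec (Fin n) k} → i v∷ u ≡ i v∷ v → u ≡ v
  tail-injective refl = refl
  head : Vec (Fin n) (suc k) → Fin n
  head (i v∷ _) = i
  head-of : ∀ {i y} → y ∈ map (i v∷_) (words k n) → head y ≡ i
  head-of {i} y∈ with ∈-map⁻ (i v∷_) y∈
  ... | _ , _ , refl = refl

Unique-Sym : ∀ n → Unique (Sym n)
Unique-Sym n = Unique.filter⁺ (λ σ → U.unique? n (toList σ)) (Unique-words n n)

word-↭ : ∀ n {σ} → σ ∈ Sym n → word σ ↭ oneTo n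
word-↭ n {σ} σ∈ = unique-⊆-⊇⇒↭ Unique-word (Unique-oneTo n) (∈-word⁻ σ)
  (unique-⊆-length⇒⊇ Unique-word (∈-word⁻ σ) (≤-reflexive (trans (length-oneTo n) (sym (word-length σ)))))
  where
  Unique-word : Unique (word σ)
  Unique-word = Unique.map⁺ (toℕ-injective ∘ suc-injective)
    (proj₂ (∈-filter⁻ (λ σ → U.unique? n (toList σ)) {xs = words n n} σ∈))

pred<-InRange : ∀ {n x} → InRange n x → pred x < n
pred<-InRange (s≤s z≤n , x≤n) = x≤n

fromWord : (n k : ℕ) (xs : List ℕ) → length xs ≡ k → All (_∈ oneTo n) xs → Vec (Fin n) k
fromWord n zero [] _ _ = v[]
fromWord n (suc k) (x ∷ xs) len (x∈ ∷ xs∈) =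
  fromℕ< (pred<-InRange (∈-oneTo⁻ n x∈)) v∷ fromWord n k xs (suc-injective len) xs∈

word-fromWord : (n k : ℕ) (xs : List ℕ) (len : length xs ≡ k) (xs∈ : All (_∈ oneTo n) xs) →
  map (λ i → suc (toℕ i)) (toList (fromWord n k xs len xs∈)) ≡ xs
word-fromWord n zero [] _ _ = refl
word-fromWord n (suc k) (x ∷ xs) len (x∈ ∷ xs∈) =
  cong₂ _∷_ (head-eq (∈-oneTo⁻ n x∈)) (word-fromWord n k xs (suc-injective len) xs∈)
  where
  head-eq : (r : InRange n x) → suc (toℕ (fromℕ< (pred<-InRange r))) ≡ x
  head-eq (s≤s z≤n , x≤n) = cong suc (toℕ-fromℕ< x≤n)

∈-map-word-Sym : ∀ n {w} → w ↭ oneTo n → w ∈ map word (Sym n)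
∈-map-word-Sym n {w} p = subst (_∈ map word (Sym n)) word-σ (∈-map⁺ word σ∈)
  where
  w⊆ : All (_∈ oneTo n) w
  w⊆ = All.tabulate (∈-resp-↭ p)
  σ : Vec (Fin n) n
  σ = fromWord n n w (trans (↭-length p) (length-oneTo n)) w⊆
  word-σ : word σ ≡ w
  word-σ = word-fromWord n n w _ w⊆
  σ∈ : σ ∈ Sym n
  σ∈ = ∈-filter⁺ (λ σ → U.unique? n (toList σ)) (∈-words n n σ)
         (Unique.map⁻ (subst Unique (sym word-σ) (Unique-resp-↭ (↭-sym p) (Unique-oneTo n))))

Sym↭perms : ∀ n → map word (Sym n) ↭ perms n
Sym↭perms n = unique-⊆-⊇⇒↭ (Unique.map⁺ word-injective (Unique-Sym n)) (Unique-perms n)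
  word∈perms (∈-map-word-Sym n ∘ perms-sound n)
  where
  word∈perms : ∀ {w} → w ∈ map word (Sym n) → w ∈ perms n
  word∈perms w∈ with ∈-map⁻ word w∈
  ... | σ , σ∈ , refl = perms-complete n (word-↭ n σ∈)

-- The statistic st is computed greedily

maxLength : List (List ℕ) → ℕ
maxLength L = foldr _⊔_ 0 (map length L)

stFrom : ℕ → List ℕ → ℕ
stFrom k e = maxLength (boolFilter (okFrom k) (subseqs e))

greedy : ℕ → List ℕ → ℕ
greedy k [] = 0
greedy k (x ∷ xs) = if k ≤ᵇ x then suc (greedy (suc k) xs) else greedy k xs

boolFilter-++ : {A : Set} (p : A → Bool) (xs ys : List A) →
                boolFilter p (xs ++ ys) ≡ boolFilter p xs ++ boolFilter p ys
boolFilter-++ p [] ys = refl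
boolFilter-++ p (x ∷ xs) ys with p x
... | true  = cong (x ∷_) (boolFilter-++ p xs ys)
... | false = boolFilter-++ p xs ys

maxLength-++ : (A B : List (List ℕ)) → maxLength (A ++ B) ≡ maxLength A ⊔ maxLength B
maxLength-++ [] B = refl
maxLength-++ (a ∷ A) B = trans (cong (length a ⊔_) (maxLength-++ A B)) (sym (⊔-assoc (length a) (maxLength A) (maxLength B)))

maxLength-map-∷ : ∀ x l L → maxLength (map (x ∷_) (l ∷ L)) ≡ suc (maxLength (l ∷ L))
maxLength-map-∷ x l [] = cong suc (sym (⊔-identityʳ (length l)))
maxLength-map-∷ x l (l′ ∷ L) = cong (suc (length l) ⊔_) (maxLength-map-∷ x l′ L)

module _ (k x : ℕ) where

  boolFilter-okFrom-map-∷-true : (k ≤ᵇ x) ≡ true → ∀ S →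
    boolFilter (okFrom k) (map (x ∷_) S) ≡ map (x ∷_) (boolFilter (okFrom (suc k)) S)
  boolFilter-okFrom-map-∷-true k≤x [] = refl
  boolFilter-okFrom-map-∷-true k≤x (s ∷ S) rewrite k≤x with okFrom (suc k) s
  ... | true  = cong ((x ∷ s) ∷_) (boolFilter-okFrom-map-∷-true k≤x S)
  ... | false = boolFilter-okFrom-map-∷-true k≤x S

  boolFilter-okFrom-map-∷-false : (k ≤ᵇ x) ≡ false → ∀ S → boolFilter (okFrom k) (map (x ∷_) S) ≡ []
  boolFilter-okFrom-map-∷-false k≰x [] = refl
  boolFilter-okFrom-map-∷-false k≰x (s ∷ S) rewrite k≰x = boolFilter-okFrom-map-∷-false k≰x S

-- The empty subsequence always qualifies.
okSubseqs-nonempty : ∀ k e → Σ (List ℕ) λ l → Σ (List (List ℕ)) λ L → boolFilter (okFrom k) (subseqs e) ≡ l ∷ L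
okSubseqs-nonempty k [] = [] , [] , refl
okSubseqs-nonempty k (x ∷ xs)
  rewrite boolFilter-++ (okFrom k) (map (x ∷_) (subseqs xs)) (subseqs xs)
  with boolFilter (okFrom k) (map (x ∷_) (subseqs xs)) | okSubseqs-nonempty k xs
... | []    | l , L , eq = l , L , eq
... | a ∷ A | _ = a , A ++ _ , refl

stFrom-∷ : ∀ k x xs → stFrom k (x ∷ xs) ≡ (if k ≤ᵇ x then suc (stFrom (suc k) xs) else 0) ⊔ stFrom k xs
stFrom-∷ k x xs
  rewrite boolFilter-++ (okFrom k) (map (x ∷_) (subseqs xs)) (subseqs xs)
        | maxLength-++ (boolFilter (okFrom k) (map (x ∷_) (subseqs xs))) (boolFilter (okFrom k) (subseqs xs))
  with k ≤ᵇ x in k≤x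
... | false rewrite boolFilter-okFrom-map-∷-false k x k≤x (subseqs xs) = refl
... | true rewrite boolFilter-okFrom-map-∷-true k x k≤x (subseqs xs) with okSubseqs-nonempty (suc k) xs
... | l , L , eq = cong (_⊔ stFrom k xs)
  (trans (cong (maxLength ∘ map (x ∷_)) eq) (trans (maxLength-map-∷ x l L) (cong (suc ∘ maxLength) (sym eq))))

stFrom≤suc : ∀ k xs → stFrom k xs ≤ suc (stFrom (suc k) xs)
stFrom≤suc k [] = z≤n
stFrom≤suc k (y ∷ ys) rewrite stFrom-∷ k y ys | stFrom-∷ (suc k) y ys with k ≤ᵇ y
... | true  = ⊔-lub (s≤s (m≤n⊔m _ _)) (≤-trans (stFrom≤suc k ys) (s≤s (m≤n⊔m _ _)))
... | false = ⊔-lub z≤n (≤-trans (stFrom≤suc k ys) (s≤s (m≤n⊔m _ _)))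

stFrom≡greedy : ∀ k xs → stFrom k xs ≡ greedy k xs
stFrom≡greedy k [] = refl
stFrom≡greedy k (x ∷ xs) rewrite stFrom-∷ k x xs with k ≤ᵇ x
... | true  = trans (m≥n⇒m⊔n≡m (stFrom≤suc k xs)) (cong suc (stFrom≡greedy (suc k) xs))
... | false = stFrom≡greedy k xs

greedy-++ : ∀ k e f → greedy k (e ++ f) ≡ greedy k e + greedy (k + greedy k e) f
greedy-++ k [] f = cong (λ k′ → greedy k′ f) (sym (+-identityʳ k))
greedy-++ k (x ∷ e) f with k ≤ᵇ x
... | true  = cong suc (trans (greedy-++ (suc k) e f) (cong (λ k′ → greedy (suc k) e + greedy k′ f) (sym (+-suc k _))))
... | false = greedy-++ k e f

greedy≤length : ∀ k e → greedy k e ≤ length e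
greedy≤length k [] = z≤n
greedy≤length k (x ∷ e) with k ≤ᵇ x
... | true  = s≤s (greedy≤length (suc k) e)
... | false = m≤n⇒m≤1+n (greedy≤length k e)

st-∷ʳ : ∀ e v → st (e ∷ʳ v) ≡ (if st e <ᵇ v then suc (st e) else st e)
st-∷ʳ e v rewrite stFrom≡greedy 1 (e ∷ʳ v) | stFrom≡greedy 1 e | greedy-++ 1 e [ v ] with greedy 1 e <ᵇ v
... | true  = +-comm (greedy 1 e) 1
... | false = +-identityʳ (greedy 1 e)

st≤length : ∀ e → st e ≤ length e
st≤length e rewrite stFrom≡greedy 1 e = greedy≤length 1 e

iter-app : ∀ w t x → iter w t (app w x) ≡ iter w (suc t) x
iter-app w zero x = refl
iter-app w (suc t) x = cong (app w) (iter-app w t x)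

firstBelow-+-hit : ∀ w j a b x → firstBelow w j a x < j → firstBelow w j (a + b) x ≡ firstBelow w j a x
firstBelow-+-hit w j zero b x hit = ⊥-elim (<-irrefl refl hit)
firstBelow-+-hit w j (suc a) b x hit with app w x <ᵇ j
... | true  = refl
... | false = firstBelow-+-hit w j a b (app w x) hit

firstBelow-+-miss : ∀ w j a b x → firstBelow w j a x ≡ j → firstBelow w j (a + b) x ≡ firstBelow w j b (iter w a x)
firstBelow-+-miss w j zero b x miss = refl
firstBelow-+-miss w j (suc a) b x miss with app w x <ᵇ j in found
... | true  = ⊥-elim (<-irrefl miss (<ᵇ-true⇒< found))
... | false = trans (firstBelow-+-miss w j a b (app w x) miss) (cong (firstBelow w j b) (iter-app w a x))

firstBelow-hit-≤ : ∀ w j a f x → a ≤ f → firstBelow w j a x < j → firstBelow w j f x ≡ firstBelow w j a x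
firstBelow-hit-≤ w j a f x a≤f hit =
  trans (cong (λ g → firstBelow w j g x) (sym (m+[n∸m]≡n a≤f))) (firstBelow-+-hit w j a (f ∸ a) x hit)

firstBelow-miss⊎hit : ∀ w j f x → firstBelow w j f x ≡ j ⊎ firstBelow w j f x < j
firstBelow-miss⊎hit w j zero x = inj₁ refl
firstBelow-miss⊎hit w j (suc f) x with app w x <ᵇ j in found
... | true  = inj₂ (<ᵇ-true⇒< found)
... | false = firstBelow-miss⊎hit w j f (app w x)

firstBelow-miss-≤ : ∀ w j a f x → a ≤ f → firstBelow w j f x ≡ j → firstBelow w j a x ≡ j
firstBelow-miss-≤ w j a f x a≤f miss with firstBelow-miss⊎hit w j a x
... | inj₁ miss′ = miss′
... | inj₂ hit = ⊥-elim (<-irrefl (trans (sym (firstBelow-hit-≤ w j a f x a≤f hit)) miss) hit)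

firstBelow-fixedPoint : ∀ w j f x → app w x ≡ x → (x <ᵇ j) ≡ false → firstBelow w j f x ≡ j
firstBelow-fixedPoint w j zero x _ _ = refl
firstBelow-fixedPoint w j (suc f) x fixed x≮j rewrite fixed | x≮j = firstBelow-fixedPoint w j f x fixed x≮j

module _ (w : List ℕ) (j p : ℕ) (1≤p : 1 ≤ p) (period : iter w p j ≡ j) where

  firstBelow-miss-periodic : firstBelow w j p j ≡ j → ∀ b → firstBelow w j b j ≡ j
  firstBelow-miss-periodic miss b = go b b ≤-refl
    where
    go : ∀ fuel b → b ≤ fuel → firstBelow w j b j ≡ j
    go fuel b b≤fuel with ≤-total b p
    ... | inj₁ b≤p = firstBelow-miss-≤ w j b p j b≤p miss
    go zero b z≤n | inj₂ _ = refl
    go (suc fuel) b b≤fuel | inj₂ p≤b = begin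
      firstBelow w j b j                ≡⟨ cong (λ g → firstBelow w j g j) (sym (m+[n∸m]≡n p≤b)) ⟩
      firstBelow w j (p + (b ∸ p)) j    ≡⟨ firstBelow-+-miss w j p (b ∸ p) j miss ⟩
      firstBelow w j (b ∸ p) (iter w p j) ≡⟨ cong (firstBelow w j (b ∸ p)) period ⟩
      firstBelow w j (b ∸ p) j          ≡⟨ go fuel (b ∸ p) (≤-trans (∸-monoʳ-≤ b 1≤p) (∸-monoˡ-≤ 1 b≤fuel)) ⟩
      j                                 ∎
      where open ≡-Reasoning

  firstBelow-periodic : ∀ f → p ≤ f → firstBelow w j f j ≡ firstBelow w j p j
  firstBelow-periodic f p≤f with firstBelow-miss⊎hit w j p j
  ... | inj₁ miss = trans (firstBelow-miss-periodic miss f) (sym miss)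
  ... | inj₂ hit  = firstBelow-hit-≤ w j p f j p≤f hit

allB-map : {A B : Set} (p : B → Bool) (g : A → B) (xs : List A) → allB p (map g xs) ≡ allB (p ∘ g) xs
allB-map p g [] = refl
allB-map p g (x ∷ xs) = cong (p (g x) ∧_) (allB-map p g xs)

allB-cong : {A : Set} {p q : A → Bool} → (∀ x → p x ≡ q x) → ∀ xs → allB p xs ≡ allB q xs
allB-cong p≡q [] = refl
allB-cong p≡q (x ∷ xs) = cong₂ _∧_ (p≡q x) (allB-cong p≡q xs)

staysAbove : List ℕ → ℕ → ℕ → ℕ → Bool
staysAbove w j f x = allB (λ t → j ≤ᵇ iter w t x) (map suc (upTo f))

staysAbove-suc : ∀ w j f x → staysAbove w j (suc f) x ≡ (j ≤ᵇ app w x) ∧ staysAbove w j f (app w x)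
staysAbove-suc w j f x = cong ((j ≤ᵇ app w x) ∧_) (begin
  allB (λ t → j ≤ᵇ iter w t x) (map suc (applyUpTo suc f))
    ≡⟨ cong (allB (λ t → j ≤ᵇ iter w t x) ∘ map suc) (sym (map-upTo suc f)) ⟩
  allB (λ t → j ≤ᵇ iter w t x) (map suc (map suc (upTo f)))
    ≡⟨ allB-map (λ t → j ≤ᵇ iter w t x) suc (map suc (upTo f)) ⟩
  allB (λ t → j ≤ᵇ iter w (suc t) x) (map suc (upTo f))
    ≡⟨ allB-cong (λ t → cong (j ≤ᵇ_) (sym (iter-app w t x))) (map suc (upTo f)) ⟩
  staysAbove w j f (app w x) ∎)
  where open ≡-Reasoning

firstBelow-miss≡staysAbove : ∀ w j f x → (j ∸ firstBelow w j f x ≡ᵇ 0) ≡ staysAbove w j f x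
firstBelow-miss≡staysAbove w j zero x rewrite n∸n≡0 j = refl
firstBelow-miss≡staysAbove w j (suc f) x rewrite staysAbove-suc w j f x with app w x <ᵇ j in found
... | true  rewrite >⇒≤ᵇ-false {j} {app w x} (<ᵇ-true⇒< found) =
  ≢⇒≡ᵇ-false (m>n⇒m∸n≢0 (<ᵇ-true⇒< {app w x} {j} found))
... | false rewrite ≤⇒≤ᵇ-true {j} {app w x} (<ᵇ-false⇒≥ found) = firstBelow-miss≡staysAbove w j f (app w x)

nth-∈ : ∀ w k → k < length w → nth w k ∈ w
nth-∈ (x ∷ w) zero _ = here refl
nth-∈ (x ∷ w) (suc k) (s≤s k<) = there (nth-∈ w k k<)

nth-injective : ∀ w {k₁ k₂} → Unique w → k₁ < length w → k₂ < length w → nth w k₁ ≡ nth w k₂ → k₁ ≡ k₂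
nth-injective (x ∷ w) {zero} {zero} _ _ _ _ = refl
nth-injective (x ∷ w) {zero} {suc k₂} (x∉ ∷ _) _ (s≤s k₂<) eq = ⊥-elim (All.lookup x∉ (nth-∈ w k₂ k₂<) eq)
nth-injective (x ∷ w) {suc k₁} {zero} (x∉ ∷ _) (s≤s k₁<) _ eq = ⊥-elim (All.lookup x∉ (nth-∈ w k₁ k₁<) (sym eq))
nth-injective (x ∷ w) {suc k₁} {suc k₂} (_ ∷ u) (s≤s k₁<) (s≤s k₂<) eq = cong suc (nth-injective w u k₁< k₂< eq)

module OnPermutation (w : List ℕ) (N : ℕ) (w↭ : w ↭ oneTo N) where

  length-w : length w ≡ N
  length-w = trans (↭-length w↭) (length-oneTo N)

  private
    index< : ∀ {x} → InRange N x → x ∸ 1 < length w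
    index< {suc x} (_ , s≤s x<N) = subst (x <_) (sym length-w) (s≤s x<N)

  app-InRange : ∀ {x} → InRange N x → InRange N (app w x)
  app-InRange x∈ = ∈-oneTo⁻ N (∈-resp-↭ w↭ (nth-∈ w _ (index< x∈)))

  app-injective : ∀ {x y} → InRange N x → InRange N y → app w x ≡ app w y → x ≡ y
  app-injective {suc x} {suc y} x∈ y∈ eq =
    cong suc (nth-injective w (Unique-resp-↭ (↭-sym w↭) (Unique-oneTo N)) (index< x∈) (index< y∈) eq)

  iter-InRange : ∀ {j} t → InRange N j → InRange N (iter w t j)
  iter-InRange zero j∈ = j∈
  iter-InRange (suc t) j∈ = app-InRange (iter-InRange t j∈)

  iter-cancel : ∀ {j} → InRange N j → ∀ a d → iter w a j ≡ iter w (a + d) j → iter w d j ≡ j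
  iter-cancel j∈ zero d eq = sym eq
  iter-cancel j∈ (suc a) d eq = iter-cancel j∈ a d (app-injective (iter-InRange a j∈) (iter-InRange (a + d) j∈) eq)

  -- Pigeonhole on j, σ(j), …, σᴺ(j) gives σⁱ(j) = σᵏ(j) with i < k, and σ cancels.
  period : ∀ {j} → InRange N j → Σ ℕ λ p → 1 ≤ p × p ≤ N × iter w p j ≡ j
  period {j} j∈ with pigeonhole ≤-refl (λ t → fromℕ< (pred<-InRange (iter-InRange (toℕ t) j∈)))
  ... | i , k , i<k , same = toℕ k ∸ toℕ i , m<n⇒0<n∸m i<k , ≤-trans (m∸n≤m (toℕ k) (toℕ i)) (≤-pred (toℕ<n k)) ,
    iter-cancel j∈ (toℕ i) (toℕ k ∸ toℕ i) (trans iterates-equal (cong (λ t → iter w t j) (sym (m+[n∸m]≡n (<⇒≤ i<k)))))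
    where
    InRange-pred-injective : ∀ {x y} → InRange N x → InRange N y → pred x ≡ pred y → x ≡ y
    InRange-pred-injective {suc x} {suc y} _ _ eq = cong suc eq
    iterates-equal : iter w (toℕ i) j ≡ iter w (toℕ k) j
    iterates-equal = InRange-pred-injective (iter-InRange (toℕ i) j∈) (iter-InRange (toℕ k) j∈)
      (trans (sym (toℕ-fromℕ< _)) (trans (cong toℕ same) (toℕ-fromℕ< _)))

  firstBelow-stable : ∀ {j} → InRange N j → ∀ f → N ≤ f → firstBelow w j f j ≡ firstBelow w j N j
  firstBelow-stable j∈ f N≤f with period j∈
  ... | p , 1≤p , p≤N , per =
    trans (firstBelow-periodic w _ p 1≤p per f (≤-trans p≤N N≤f)) (sym (firstBelow-periodic w _ p 1≤p per N p≤N))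

-- Inserting n+1 into a cycle

replace : ℕ → ℕ → List ℕ → List ℕ
replace a b = map (λ y → if y ≡ᵇ a then b else y)

-- For v = 0 the new letter n+1 becomes a fixed point; otherwise it is spliced into the
-- cycle of a = n+1−v just before a, so that σ′(n+1) = a and hence s_{n+1}(σ′) = v.
insertInCycle : ℕ → List ℕ → ℕ → List ℕ
insertInCycle n w zero = w ∷ʳ suc n
insertInCycle n w (suc u) = replace (n ∸ u) (suc n) w ∷ʳ (n ∸ u)

sorCode : ℕ → List ℕ → List ℕ
sorCode n w = map (λ j → j ∸ cW w n j) (oneTo n)

Triple : Set
Triple = ℕ × ℕ × ℕ

sorTriple : ℕ → List ℕ → Triple
sorTriple n w = countB (isCycleMin w n) (oneTo n) , st (sorCode n w) , sum (sorCode n w)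

step : Triple → ℕ → Triple
step (r , d , m) zero = suc r , d , m
step (r , d , m) (suc u) = r , (if d <ᵇ suc u then suc d else d) , m + suc u

cycleMins≡zeros : ∀ n w → countB (isCycleMin w n) (oneTo n) ≡ countB (_≡ᵇ 0) (sorCode n w)
cycleMins≡zeros n w = trans (countB-cong-∈ _ _ (oneTo n) (λ {j} _ → sym (firstBelow-miss≡staysAbove w j n j)))
  (countB-map (_≡ᵇ 0) (λ j → j ∸ cW w n j) (oneTo n))

zeros-st-sum-∷ʳ : ∀ c v →
  (countB (_≡ᵇ 0) (c ∷ʳ v) , st (c ∷ʳ v) , sum (c ∷ʳ v)) ≡ step (countB (_≡ᵇ 0) c , st c , sum c) v
zeros-st-sum-∷ʳ c zero rewrite countB-++ (_≡ᵇ 0) c [ 0 ] | st-∷ʳ c 0 | sum-++ c [ 0 ] =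
  cong₂ _,_ (+-comm _ 1) (cong (st c ,_) (+-identityʳ _))
zeros-st-sum-∷ʳ c (suc u) rewrite countB-++ (_≡ᵇ 0) c [ suc u ] | st-∷ʳ c (suc u) | sum-++ c [ suc u ] =
  cong₂ _,_ (+-identityʳ _) (cong ((if st c <ᵇ suc u then suc (st c) else st c) ,_) (cong (sum c +_) (+-identityʳ _)))

nth-∷ʳ-< : ∀ L z k → k < length L → nth (L ∷ʳ z) k ≡ nth L k
nth-∷ʳ-< (x ∷ L) z zero _ = refl
nth-∷ʳ-< (x ∷ L) z (suc k) (s≤s k<) = nth-∷ʳ-< L z k k<

nth-∷ʳ-length : ∀ L z → nth (L ∷ʳ z) (length L) ≡ z
nth-∷ʳ-length [] z = refl
nth-∷ʳ-length (x ∷ L) z = nth-∷ʳ-length L z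

app-∷ʳ-last : ∀ n L z → length L ≡ n → app (L ∷ʳ z) (suc n) ≡ z
app-∷ʳ-last n L z refl = nth-∷ʳ-length L z

nth-map : ∀ (g : ℕ → ℕ) L k → k < length L → nth (map g L) k ≡ g (nth L k)
nth-map g (x ∷ L) zero _ = refl
nth-map g (x ∷ L) (suc k) (s≤s k<) = nth-map g L k k<

Splice : (τ w : List ℕ) (n : ℕ) → Set
Splice τ w n = ∀ {y} → InRange n y → app τ y ≡ app w y ⊎ (app τ y ≡ suc n × app τ (suc n) ≡ app w y)

-- A walk along τ visits the elements of the walk along w, with possible detours
-- through n+1, which is never below j.
firstBelow-splice : ∀ τ w n j → j ≤ n → Splice τ w n → (∀ {y} → InRange n y → InRange n (app w y)) →
  ∀ f {x} → InRange n x → Σ ℕ λ f′ → f ≤ f′ × firstBelow τ j f′ x ≡ firstBelow w j f x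
firstBelow-splice τ w n j j≤n splice closed zero x∈ = 0 , z≤n , refl
firstBelow-splice τ w n j j≤n splice closed (suc f) {x} x∈
  with splice x∈ | firstBelow-splice τ w n j j≤n splice closed f (closed x∈)
... | inj₁ same | f′ , f≤f′ , walk = suc f′ , s≤s f≤f′ ,
  trans (cong (λ y → if y <ᵇ j then y else firstBelow τ j f′ y) same) (cong (if app w x <ᵇ j then app w x else_) walk)
... | inj₂ (to-new , from-new) | f′ , f≤f′ , walk = suc (suc f′) , s≤s (m≤n⇒m≤1+n f≤f′) , detour
  where
  open ≡-Reasoning
  detour : firstBelow τ j (suc (suc f′)) x ≡ firstBelow w j (suc f) x
  detour = begin
    firstBelow τ j (suc (suc f′)) x
      ≡⟨ cong (λ y → if y <ᵇ j then y else firstBelow τ j (suc f′) y) to-new ⟩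
    (if suc n <ᵇ j then suc n else firstBelow τ j (suc f′) (suc n))
      ≡⟨ cong (if_then suc n else firstBelow τ j (suc f′) (suc n)) (≥⇒<ᵇ-false (m≤n⇒m≤1+n j≤n)) ⟩
    firstBelow τ j (suc f′) (suc n)
      ≡⟨ cong (λ y → if y <ᵇ j then y else firstBelow τ j f′ y) from-new ⟩
    (if app w x <ᵇ j then app w x else firstBelow τ j f′ (app w x))
      ≡⟨ cong (if app w x <ᵇ j then app w x else_) walk ⟩
    firstBelow w j (suc f) x ∎

nth-replace-∷ʳ : ∀ a b w z y → y < length w → nth (replace a b w ∷ʳ z) y ≡ (if nth w y ≡ᵇ a then b else nth w y)
nth-replace-∷ʳ a b w z y y< = trans (nth-∷ʳ-< (replace a b w) z y (subst (y <_) (sym (length-map _ w)) y<)) (nth-map _ w y y<)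

insertInCycle-splice : ∀ n w v → length w ≡ n → Splice (insertInCycle n w v) w n
insertInCycle-splice n w zero len {suc y} (_ , y<n) = inj₁ (nth-∷ʳ-< w (suc n) y (subst (y <_) (sym len) y<n))
insertInCycle-splice n w (suc u) len {suc y} (_ , y<n) with nth w y ≡ᵇ (n ∸ u) in hit
... | true  = inj₂ (trans (nth-replace-∷ʳ (n ∸ u) (suc n) w (n ∸ u) y y<len) (cong (if_then suc n else nth w y) hit) ,
                   trans (app-∷ʳ-last n (replace (n ∸ u) (suc n) w) (n ∸ u) (trans (length-map _ w) len))
                         (sym (≡ᵇ-true⇒≡ hit)))
  where
  y<len : y < length w
  y<len = subst (y <_) (sym len) y<n
... | false = inj₁ (trans (nth-replace-∷ʳ (n ∸ u) (suc n) w (n ∸ u) y y<len) (cong (if_then suc n else nth w y) hit))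
  where
  y<len : y < length w
  y<len = subst (y <_) (sym len) y<n

replace-∉ : ∀ a b xs → a ∉ xs → replace a b xs ≡ xs
replace-∉ a b xs a∉ = trans (map-cong-∈ _ (λ y → y) xs (λ {y} y∈ →
  cong (if_then b else y) (≢⇒≡ᵇ-false (λ y≡a → a∉ (subst (_∈ xs) y≡a y∈))))) (map-id xs)

replace-middle : ∀ as bs a b → a ∉ as ++ bs → replace a b (as ++ a ∷ bs) ≡ as ++ b ∷ bs
replace-middle as bs a b a∉ = trans (map-++ _ as (a ∷ bs))
  (cong₂ _++_ (replace-∉ a b as (a∉ ∘ ∈-++⁺ˡ))
              (cong₂ _∷_ (cong (if_then b else a) (≡ᵇ-refl a)) (replace-∉ a b bs (a∉ ∘ ∈-++⁺ʳ as))))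

replace-cancel : ∀ a b xs → b ∉ xs → replace b a (replace a b xs) ≡ xs
replace-cancel a b xs b∉ = trans (sym (map-∘ xs)) (trans (map-cong-∈ _ (λ y → y) xs back) (map-id xs))
  where
  back : ∀ {y} → y ∈ xs → (if (if y ≡ᵇ a then b else y) ≡ᵇ b then a else (if y ≡ᵇ a then b else y)) ≡ y
  back {y} y∈ with y ≡ᵇ a in y≟a
  ... | true  rewrite ≡ᵇ-refl b = sym (≡ᵇ-true⇒≡ y≟a)
  ... | false rewrite ≢⇒≡ᵇ-false {y} {b} (λ y≡b → b∉ (subst (_∈ xs) y≡b y∈)) = refl

∉-middle : ∀ as bs (a : ℕ) → Unique (as ++ a ∷ bs) → a ∉ as ++ bs
∉-middle as bs a u a∈ with Unique-resp-↭ (shift a as bs) u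
... | a∉ ∷ _ = All.lookup a∉ a∈ refl

swap-ends : ∀ (as bs : List ℕ) a b → as ++ a ∷ bs ∷ʳ b ↭ as ++ b ∷ bs ∷ʳ a
swap-ends as bs a b = ++⁺ˡ as (↭-trans (prep a (↭-sym (∷↭∷ʳ b bs))) (↭-trans (swap a b ↭-refl) (prep b (∷↭∷ʳ a bs))))

insertInCycle-split : ∀ n w u → w ↭ oneTo n → u < n →
  Σ (List ℕ) λ as → Σ (List ℕ) λ bs → w ≡ as ++ (n ∸ u) ∷ bs × insertInCycle n w (suc u) ≡ as ++ suc n ∷ bs ∷ʳ (n ∸ u)
insertInCycle-split n w u w↭ u<n with ∈-∃++ (∈-resp-↭ (↭-sym w↭) (∈-oneTo⁺ n (m<n⇒0<n∸m u<n , m∸n≤m n u)))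
... | as , bs , refl = as , bs , refl ,
  trans (cong (_∷ʳ (n ∸ u)) (replace-middle as bs (n ∸ u) (suc n) (∉-middle as bs _ (Unique-resp-↭ (↭-sym w↭) (Unique-oneTo n)))))
        (++-assoc as (suc n ∷ bs) [ n ∸ u ])

insertInCycle-↭ : ∀ n w v → w ↭ oneTo n → v ≤ n → insertInCycle n w v ↭ oneTo (suc n)
insertInCycle-↭ n w zero w↭ _ = ↭-trans (++⁺ʳ [ suc n ] w↭) (↭-reflexive (sym (oneTo-suc n)))
insertInCycle-↭ n w (suc u) w↭ u<n with insertInCycle-split n w u w↭ u<n
... | as , bs , refl , eq = begin
  insertInCycle n w (suc u)       ≡⟨ eq ⟩
  as ++ suc n ∷ bs ∷ʳ (n ∸ u)     ↭⟨ swap-ends as bs (suc n) (n ∸ u) ⟩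
  as ++ (n ∸ u) ∷ bs ∷ʳ suc n     ≡⟨ ++-assoc as ((n ∸ u) ∷ bs) [ suc n ] ⟨
  w ∷ʳ suc n                      ↭⟨ insertInCycle-↭ n w 0 w↭ z≤n ⟩
  oneTo (suc n)                   ∎
  where open PermutationReasoning

insertInCycle-lastEntry : ∀ n w v → v ≤ n → length w ≡ n →
  suc n ∸ cW (insertInCycle n w v) (suc n) (suc n) ≡ v
insertInCycle-lastEntry n w zero _ len
  rewrite app-∷ʳ-last n w (suc n) len | ≥⇒<ᵇ-false {suc n} {suc n} ≤-refl
        | firstBelow-fixedPoint (w ∷ʳ suc n) (suc n) n (suc n) (app-∷ʳ-last n w (suc n) len) (≥⇒<ᵇ-false {suc n} ≤-refl)
  = n∸n≡0 n
insertInCycle-lastEntry n w (suc u) u<n len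
  rewrite app-∷ʳ-last n (replace (n ∸ u) (suc n) w) (n ∸ u) (trans (length-map _ w) len)
        | <⇒<ᵇ-true {n ∸ u} {suc n} (s≤s (m∸n≤m n u))
  = trans (+-∸-assoc 1 (m∸n≤m n u)) (cong suc (m∸[m∸n]≡n (<⇒≤ u<n)))

module _ (n : ℕ) (w : List ℕ) (v : ℕ) (v≤n : v ≤ n) (w↭ : w ↭ oneTo n) where

  private
    τ : List ℕ
    τ = insertInCycle n w v
    module W = OnPermutation w n w↭
    module T = OnPermutation τ (suc n) (insertInCycle-↭ n w v w↭ v≤n)

  cW-insertInCycle : ∀ {j} → InRange n j → cW τ (suc n) j ≡ cW w n j
  cW-insertInCycle {j} j∈ with firstBelow-splice τ w n j (proj₂ j∈) (insertInCycle-splice n w v W.length-w) W.app-InRange (suc n) j∈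
  ... | f′ , n<f′ , walk = trans (sym (T.firstBelow-stable j∈′ f′ n<f′)) (trans walk (W.firstBelow-stable j∈ (suc n) (n≤1+n n)))
    where
    j∈′ : InRange (suc n) j
    j∈′ = proj₁ j∈ , m≤n⇒m≤1+n (proj₂ j∈)

  sorCode-insertInCycle : sorCode (suc n) τ ≡ sorCode n w ∷ʳ v
  sorCode-insertInCycle = begin
    map entry (oneTo (suc n))                        ≡⟨ cong (map entry) (oneTo-suc n) ⟩
    map entry (oneTo n ∷ʳ suc n)                     ≡⟨ map-++ entry (oneTo n) [ suc n ] ⟩
    map entry (oneTo n) ∷ʳ entry (suc n)             ≡⟨ cong₂ _∷ʳ_ same-entries (insertInCycle-lastEntry n w v v≤n W.length-w) ⟩
    sorCode n w ∷ʳ v                                 ∎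
    where
    open ≡-Reasoning
    entry : ℕ → ℕ
    entry j = j ∸ cW τ (suc n) j
    same-entries : map entry (oneTo n) ≡ sorCode n w
    same-entries = map-cong-∈ _ _ (oneTo n) (λ j∈ → cong (_ ∸_) (cW-insertInCycle (∈-oneTo⁻ n j∈)))

  sorTriple-insertInCycle : sorTriple (suc n) τ ≡ step (sorTriple n w) v
  sorTriple-insertInCycle = begin
    sorTriple (suc n) τ
      ≡⟨ cong (_, st (sorCode (suc n) τ) , sum (sorCode (suc n) τ)) (cycleMins≡zeros (suc n) τ) ⟩
    (countB (_≡ᵇ 0) (sorCode (suc n) τ) , st (sorCode (suc n) τ) , sum (sorCode (suc n) τ))
      ≡⟨ cong (λ c → countB (_≡ᵇ 0) c , st c , sum c) sorCode-insertInCycle ⟩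
    (countB (_≡ᵇ 0) (sorCode n w ∷ʳ v) , st (sorCode n w ∷ʳ v) , sum (sorCode n w ∷ʳ v))
      ≡⟨ zeros-st-sum-∷ʳ (sorCode n w) v ⟩
    step (countB (_≡ᵇ 0) (sorCode n w) , st (sorCode n w) , sum (sorCode n w)) v
      ≡⟨ cong (λ z → step (z , st (sorCode n w) , sum (sorCode n w)) v) (cycleMins≡zeros n w) ⟨
    step (sorTriple n w) v ∎
    where open ≡-Reasoning

insertInCycle-injective : ∀ n {w w′ v v′} → suc n ∉ w → suc n ∉ w′ → v ≤ n → v′ ≤ n →
  insertInCycle n w v ≡ insertInCycle n w′ v′ → w ≡ w′ × v ≡ v′
insertInCycle-injective n {w} {w′} {zero} {zero} _ _ _ _ eq = proj₁ (∷ʳ-injective w w′ eq) , refl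
insertInCycle-injective n {w} {v = zero} {suc u′} _ _ _ _ eq =
  ⊥-elim (<-irrefl (sym (proj₂ (∷ʳ-injective w _ eq))) (s≤s (m∸n≤m n u′)))
insertInCycle-injective n {w′ = w′} {suc u} {zero} _ _ _ _ eq =
  ⊥-elim (<-irrefl (proj₂ (∷ʳ-injective _ w′ eq)) (s≤s (m∸n≤m n u)))
insertInCycle-injective n {w} {w′} {suc u} {suc u′} sn∉w sn∉w′ u<n u′<n eq
  with ∷ʳ-injective (replace (n ∸ u) (suc n) w) (replace (n ∸ u′) (suc n) w′) eq
... | same-body , same-last = w≡w′ , cong suc u≡u′
  where
  u≡u′ : u ≡ u′
  u≡u′ = trans (sym (m∸[m∸n]≡n (<⇒≤ u<n))) (trans (cong (n ∸_) same-last) (m∸[m∸n]≡n (<⇒≤ u′<n)))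
  w≡w′ : w ≡ w′
  w≡w′ = begin
    w                                                      ≡⟨ replace-cancel (n ∸ u) (suc n) w sn∉w ⟨
    replace (suc n) (n ∸ u) (replace (n ∸ u) (suc n) w)    ≡⟨ cong (replace (suc n) (n ∸ u)) same-body ⟩
    replace (suc n) (n ∸ u) (replace (n ∸ u′) (suc n) w′)  ≡⟨ cong (λ k → replace (suc n) (n ∸ k) _) u≡u′ ⟩
    replace (suc n) (n ∸ u′) (replace (n ∸ u′) (suc n) w′) ≡⟨ replace-cancel (n ∸ u′) (suc n) w′ sn∉w′ ⟩
    w′                                                     ∎
    where open ≡-Reasoning

insertInCycle-surjective : ∀ n {x} → x ↭ oneTo (suc n) →
  Σ (List ℕ) λ w → Σ ℕ λ v → w ↭ oneTo n × v ≤ n × insertInCycle n w v ≡ x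
insertInCycle-surjective n {x} x↭ with initLast x
... | [] = ⊥-elim (0≢1+n (trans (↭-length x↭) (length-oneTo (suc n))))
insertInCycle-surjective n {x} x↭ | i ∷ʳ′ l with l ≡ᵇ suc n in l≟
... | true with refl ← ≡ᵇ-true⇒≡ {l} {suc n} l≟ =
  i , 0 , ↭-trans (↭-reflexive (sym (++-identityʳ i))) (oneTo-suc-split n {i} {[]} x↭) , z≤n , refl
... | false with ∈-++⁻ i (∈-resp-↭ (↭-sym x↭) (∈-oneTo⁺ (suc n) (s≤s z≤n , ≤-refl)))
...   | inj₂ (here sn≡l) = ⊥-elim (≡ᵇ-false⇒≢ l≟ (sym sn≡l))
...   | inj₁ sn∈i with ∈-∃++ sn∈i
...     | as , bs , refl = as ++ l ∷ bs , suc (n ∸ l) , w↭ , u<n , image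
  where
  l∈ : InRange (suc n) l
  l∈ = ∈-oneTo⁻ (suc n) (∈-resp-↭ x↭ (∈-++⁺ʳ (as ++ suc n ∷ bs) (here refl)))
  l≤n : l ≤ n
  l≤n with m≤n⇒m<n∨m≡n (proj₂ l∈)
  ... | inj₁ l<sn = ≤-pred l<sn
  ... | inj₂ l≡sn = ⊥-elim (≡ᵇ-false⇒≢ l≟ l≡sn)
  u<n : n ∸ l < n
  u<n = ∸-monoʳ-< {n} {l} {0} (proj₁ l∈) l≤n
  w↭ : as ++ l ∷ bs ↭ oneTo n
  w↭ = ↭-trans (↭-reflexive (sym (++-identityʳ _))) (oneTo-suc-split n {as ++ l ∷ bs} {[]} (begin
    (as ++ l ∷ bs) ∷ʳ suc n     ≡⟨ ++-assoc as (l ∷ bs) [ suc n ] ⟩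
    as ++ l ∷ bs ∷ʳ suc n       ↭⟨ swap-ends as bs l (suc n) ⟩
    as ++ suc n ∷ bs ∷ʳ l       ≡⟨ ++-assoc as (suc n ∷ bs) [ l ] ⟨
    (as ++ suc n ∷ bs) ∷ʳ l     ↭⟨ x↭ ⟩
    oneTo (suc n)               ∎))
    where open PermutationReasoning
  image : insertInCycle n (as ++ l ∷ bs) (suc (n ∸ l)) ≡ (as ++ suc n ∷ bs) ∷ʳ l
  image rewrite m∸[m∸n]≡n l≤n =
    cong (_∷ʳ l) (replace-middle as bs l (suc n) (∉-middle as bs l (Unique-resp-↭ (↭-sym w↭) (Unique-oneTo n))))

cycleInsertions : ℕ → List ℕ → List (List ℕ)
cycleInsertions n w = map (insertInCycle n w) (upTo (suc n))

perms-suc↭cycleInsertions : ∀ n → perms (suc n) ↭ concatMap (cycleInsertions n) (perms n)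
perms-suc↭cycleInsertions n = unique-⊆-⊇⇒↭ (Unique-perms (suc n)) unique ⊆ ⊇
  where
  image : ∀ {w x} → x ∈ cycleInsertions n w → Σ ℕ λ v → v ≤ n × insertInCycle n w v ≡ x
  image x∈ with ∈-map⁻ _ x∈
  ... | v , v∈ , refl = v , ≤-pred (∈-upTo⁻ v∈) , refl
  unique : Unique (concatMap (cycleInsertions n) (perms n))
  unique = Unique-concatMap (cycleInsertions n) (Unique-perms n)
    (λ w∈ → Unique-map-injectiveOn _ (Unique.upTo⁺ (suc n)) λ v∈ v′∈ eq →
      proj₂ (insertInCycle-injective n (perms-suc∉ n w∈) (perms-suc∉ n w∈)
                                       (≤-pred (∈-upTo⁻ v∈)) (≤-pred (∈-upTo⁻ v′∈)) eq))
    (λ w∈ w′∈ x∈ x∈′ → disjoint w∈ w′∈ (image x∈) (image x∈′))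
    where
    disjoint : ∀ {w w′ x} → w ∈ perms n → w′ ∈ perms n →
      (Σ ℕ λ v → v ≤ n × insertInCycle n w v ≡ x) → (Σ ℕ λ v′ → v′ ≤ n × insertInCycle n w′ v′ ≡ x) → w ≡ w′
    disjoint w∈ w′∈ (v , v≤ , refl) (v′ , v′≤ , eq) =
      proj₁ (insertInCycle-injective n (perms-suc∉ n w∈) (perms-suc∉ n w′∈) v≤ v′≤ (sym eq))
  ⊆ : ∀ {x} → x ∈ perms (suc n) → x ∈ concatMap (cycleInsertions n) (perms n)
  ⊆ x∈ with insertInCycle-surjective n (perms-sound (suc n) x∈)
  ... | w , v , w↭ , v≤n , refl = ∈-concatMap⁺ (cycleInsertions n) {xs = perms n}
    (lose (perms-complete n w↭) (∈-map⁺ (insertInCycle n w) (∈-upTo⁺ (s≤s v≤n))))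
  ⊇ : ∀ {x} → x ∈ concatMap (cycleInsertions n) (perms n) → x ∈ perms (suc n)
  ⊇ x∈ with find (∈-concatMap⁻ (cycleInsertions n) {xs = perms n} x∈)
  ... | w , w∈ , x∈′ with image x∈′
  ... | v , v≤n , refl = perms-complete (suc n) (insertInCycle-↭ n w v (perms-sound n w∈) v≤n)

-- rlmin, des and maj under insertion of a maximal letter

desW : List ℕ → ℕ
desW w = length (descents w)

majW : List ℕ → ℕ
majW w = sum (descents w)

majTriple : List ℕ → Triple
majTriple w = rlminW w , desW w , majW w

descentsFrom-suc : ∀ i w → descentsFrom (suc i) w ≡ map suc (descentsFrom i w)
descentsFrom-suc i [] = refl
descentsFrom-suc i (a ∷ []) = refl
descentsFrom-suc i (a ∷ b ∷ w) = trans (cong₂ _++_ (head-shift (b <ᵇ a)) (descentsFrom-suc (suc i) (b ∷ w)))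
  (sym (map-++ suc (if b <ᵇ a then [ i ] else []) (descentsFrom (suc i) (b ∷ w))))
  where
  head-shift : ∀ c → (if c then [ suc i ] else []) ≡ map suc (if c then [ i ] else [])
  head-shift true  = refl
  head-shift false = refl

sum-map-suc : ∀ xs → sum (map suc xs) ≡ sum xs + length xs
sum-map-suc [] = refl
sum-map-suc (x ∷ xs) = trans (cong (suc x +_) (sum-map-suc xs)) (lemma x (sum xs) (length xs))
  where
  lemma : ∀ a b c → suc a + (b + c) ≡ (a + b) + suc c
  lemma = solve-∀

bit : Bool → ℕ
bit true  = 1
bit false = 0

desW-∷∷ : ∀ a b w → desW (a ∷ b ∷ w) ≡ bit (b <ᵇ a) + desW (b ∷ w)
desW-∷∷ a b w with b <ᵇ a
... | true  = cong suc (trans (cong length (descentsFrom-suc 1 (b ∷ w))) (length-map suc (descents (b ∷ w))))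
... | false = trans (cong length (descentsFrom-suc 1 (b ∷ w))) (length-map suc (descents (b ∷ w)))

majW-∷∷ : ∀ a b w → majW (a ∷ b ∷ w) ≡ bit (b <ᵇ a) + (majW (b ∷ w) + desW (b ∷ w))
majW-∷∷ a b w with b <ᵇ a
... | true  = cong suc (trans (cong sum (descentsFrom-suc 1 (b ∷ w))) (sum-map-suc (descents (b ∷ w))))
... | false = trans (cong sum (descentsFrom-suc 1 (b ∷ w))) (sum-map-suc (descents (b ∷ w)))

desW≤length : ∀ b w → desW (b ∷ w) ≤ length w
desW≤length b [] = z≤n
desW≤length b (c ∷ w) rewrite desW-∷∷ b c w with c <ᵇ b
... | true  = s≤s (desW≤length c w)
... | false = m≤n⇒m≤1+n (desW≤length c w)

triple-≡ : ∀ {a a′ b b′ c c′ : ℕ} → a ≡ a′ → b ≡ b′ → c ≡ c′ → (a , b , c) ≡ (a′ , b′ , c′)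
triple-≡ refl refl refl = refl

bit-if : ∀ c → (if c then 1 else 0) ≡ bit c
bit-if true  = refl
bit-if false = refl

majTriple-∷∷ : ∀ a b w → majTriple (a ∷ b ∷ w) ≡
  (bit (allB (a <ᵇ_) (b ∷ w)) + rlminW (b ∷ w) , bit (b <ᵇ a) + desW (b ∷ w) , bit (b <ᵇ a) + (majW (b ∷ w) + desW (b ∷ w)))
majTriple-∷∷ a b w = triple-≡ (cong (_+ rlminW (b ∷ w)) (bit-if (allB (a <ᵇ_) (b ∷ w)))) (desW-∷∷ a b w) (majW-∷∷ a b w)

allB-insertions : ∀ (p : ℕ → Bool) M w {y} → y ∈ insertions M w → allB p y ≡ allB p (M ∷ w)
allB-insertions p M [] (here refl) = refl
allB-insertions p M (a ∷ w) (here refl) = refl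
allB-insertions p M (a ∷ w) (there y∈) with ∈-map⁻ (a ∷_) y∈
... | y′ , y′∈ , refl rewrite allB-insertions p M w y′∈ = ∧-swap (p a) (p M) (allB p w)
  where
  ∧-swap : ∀ x y z → x ∧ (y ∧ z) ≡ y ∧ (x ∧ z)
  ∧-swap true  _ _ = refl
  ∧-swap false true  _ = refl
  ∧-swap false false _ = refl

countFrom : ℕ → ℕ → List ℕ
countFrom s zero = []
countFrom s (suc k) = s ∷ countFrom (suc s) k

countFrom-suc : ∀ s k → countFrom s (suc k) ≡ countFrom s k ∷ʳ (s + k)
countFrom-suc s zero = cong [_] (sym (+-identityʳ s))
countFrom-suc s (suc k) = cong (s ∷_) (trans (countFrom-suc (suc s) k) (cong (countFrom (suc s) k ∷ʳ_) (sym (+-suc s k))))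

raises : Triple → List ℕ → List Triple
raises (r , d , m) = map (λ x → r , d , m + x)

raises-countFrom-suc : ∀ r d m s k → raises (r , d , suc m) (countFrom s k) ≡ raises (r , d , m) (countFrom (suc s) k)
raises-countFrom-suc r d m s zero = refl
raises-countFrom-suc r d m s (suc k) = cong₂ _∷_ (cong (λ z → r , d , z) (sym (+-suc m s))) (raises-countFrom-suc r d m (suc s) k)

raises-countFrom-suc-++ : ∀ t s k B → raises t (countFrom s (suc k)) ++ B ≡ raises t (countFrom s k) ++ raises t [ s + k ] ++ B
raises-countFrom-suc-++ t s k B = trans (cong (λ xs → raises t xs ++ B) (countFrom-suc s k))
  (trans (cong (_++ B) (map-++ _ (countFrom s k) [ s + k ])) (++-assoc (raises t (countFrom s k)) _ B))

successors : ℕ → Triple → List Triple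
successors n (r , d , m) = (suc r , d , m) ∷ raises (r , d , m) (countFrom 1 d) ++ raises (r , suc d , m) (countFrom (suc d) (n ∸ d))

-- successors without the triple (r, d+1, m+d+1), which comes from inserting in front.
laterSuccessors : Triple → ℕ → List Triple
laterSuccessors (r , d , m) k =
  (suc r , d , m) ∷ raises (r , d , m) (countFrom 1 d) ++ raises (r , suc d , m) (countFrom (suc (suc d)) k)

-- Prepending a letter adds β right-to-left minima and c descents, and shifts every old descent by one.
prepended : ℕ → ℕ → Triple → Triple
prepended β c (r , d , m) = β + r , c + d , c + (m + d)

map-prepended-raises : ∀ β c r d m xs → map (prepended β c) (raises (r , d , m) xs) ≡ raises (β + r , c + d , c + (m + d)) xs
map-prepended-raises β c r d m xs =
  trans (sym (map-∘ xs)) (map-cong-∈ _ _ xs (λ {x} _ → cong (λ z → β + r , c + d , z) (lemma c m x d)))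
  where
  lemma : ∀ c m x d → c + ((m + x) + d) ≡ (c + (m + d)) + x
  lemma = solve-∀

rotate : ∀ (F X : Triple) A B → F ∷ X ∷ A ++ B ↭ X ∷ A ++ F ∷ B
rotate F X A B = ↭-sym (shift F (X ∷ A) B)

prepended-laterSuccessors : ∀ c β r d m L → d ≤ L →
  (β + r , suc d , suc (m + d) + suc d) ∷ map (prepended β (bit c)) (laterSuccessors (r , d , m) (L ∸ d)) ↭
  laterSuccessors (prepended β (bit c) (r , d , m)) (suc L ∸ (bit c + d))
prepended-laterSuccessors false β r d m L d≤L
  rewrite +-∸-assoc 1 d≤L
        | map-++ (prepended β 0) (raises (r , d , m) (countFrom 1 d)) (raises (r , suc d , m) (countFrom (suc (suc d)) (L ∸ d)))
        | map-prepended-raises β 0 r d m (countFrom 1 d)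
        | map-prepended-raises β 0 r (suc d) m (countFrom (suc (suc d)) (L ∸ d))
        | +-suc m d
        | raises-countFrom-suc (β + r) (suc d) (m + d) (suc (suc d)) (L ∸ d)
  = ↭-trans (rotate _ _ _ _) (↭-reflexive (cong₂ _∷_ (cong (_, d , m + d) (+-suc β r))
      (cong (raises (β + r , d , m + d) (countFrom 1 d) ++_)
            (cong (λ z → (β + r , suc d , z) ∷ raises (β + r , suc d , m + d) (countFrom (3 + d) (L ∸ d))) (lemma m d)))))
  where
  lemma : ∀ m d → suc (m + d) + suc d ≡ (m + d) + suc (suc d)
  lemma = solve-∀
prepended-laterSuccessors true β r d m L d≤L
  rewrite map-++ (prepended β 1) (raises (r , d , m) (countFrom 1 d)) (raises (r , suc d , m) (countFrom (suc (suc d)) (L ∸ d)))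
        | map-prepended-raises β 1 r d m (countFrom 1 d)
        | map-prepended-raises β 1 r (suc d) m (countFrom (suc (suc d)) (L ∸ d))
        | +-suc m d
        | raises-countFrom-suc (β + r) (suc (suc d)) (suc (m + d)) (suc (suc d)) (L ∸ d)
  = ↭-trans (rotate _ _ _ _) (↭-reflexive (cong₂ _∷_ (cong (_, suc d , suc (m + d)) (+-suc β r))
      (sym (raises-countFrom-suc-++ (β + r , suc d , suc (m + d)) 1 d _))))

laterInsertions-triples : ∀ M a w → a < M → All (_< M) w →
  map majTriple (map (a ∷_) (insertions M w)) ↭ laterSuccessors (majTriple (a ∷ w)) (length w ∸ desW (a ∷ w))
laterInsertions-triples M a [] a<M [] rewrite <⇒<ᵇ-true a<M | ≥⇒<ᵇ-false {M} {a} (<⇒≤ a<M) = ↭-refl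
laterInsertions-triples M a (b ∷ w) a<M (b<M ∷ w<M) = begin
  majTriple (a ∷ M ∷ b ∷ w) ∷ map majTriple (map (a ∷_) (map (b ∷_) (insertions M w)))
    ≡⟨ cong₂ _∷_ front later ⟩
  (β + rlminW (b ∷ w) , suc (desW (b ∷ w)) , suc (majW (b ∷ w) + desW (b ∷ w)) + suc (desW (b ∷ w)))
    ∷ map (prepended β (bit c)) (map majTriple (map (b ∷_) (insertions M w)))
    ↭⟨ prep _ (map⁺ (prepended β (bit c)) (laterInsertions-triples M b w b<M w<M)) ⟩
  _ ∷ map (prepended β (bit c)) (laterSuccessors (majTriple (b ∷ w)) (length w ∸ desW (b ∷ w)))
    ↭⟨ prepended-laterSuccessors c β (rlminW (b ∷ w)) (desW (b ∷ w)) (majW (b ∷ w)) (length w) (desW≤length b w) ⟩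
  laterSuccessors (prepended β (bit c) (majTriple (b ∷ w))) (suc (length w) ∸ (bit c + desW (b ∷ w)))
    ≡⟨ cong₂ laterSuccessors (majTriple-∷∷ a b w) (cong (suc (length w) ∸_) (desW-∷∷ a b w)) ⟨
  laterSuccessors (majTriple (a ∷ b ∷ w)) (length (b ∷ w) ∸ desW (a ∷ b ∷ w)) ∎
  where
  open PermutationReasoning
  β : ℕ
  β = bit (allB (a <ᵇ_) (b ∷ w))
  c : Bool
  c = b <ᵇ a
  front : majTriple (a ∷ M ∷ b ∷ w) ≡
    (β + rlminW (b ∷ w) , suc (desW (b ∷ w)) , suc (majW (b ∷ w) + desW (b ∷ w)) + suc (desW (b ∷ w)))
  front = trans (majTriple-∷∷ a M (b ∷ w)) (triple-≡ rlmin-eq des-eq maj-eq)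
    where
    rlmin-eq : bit (allB (a <ᵇ_) (M ∷ b ∷ w)) + rlminW (M ∷ b ∷ w) ≡ β + rlminW (b ∷ w)
    rlmin-eq rewrite <⇒<ᵇ-true a<M | ≥⇒<ᵇ-false {M} {b} (<⇒≤ b<M) = refl
    des-eq : bit (M <ᵇ a) + desW (M ∷ b ∷ w) ≡ suc (desW (b ∷ w))
    des-eq rewrite ≥⇒<ᵇ-false {M} {a} (<⇒≤ a<M) | desW-∷∷ M b w | <⇒<ᵇ-true b<M = refl
    maj-eq : bit (M <ᵇ a) + (majW (M ∷ b ∷ w) + desW (M ∷ b ∷ w)) ≡ suc (majW (b ∷ w) + desW (b ∷ w)) + suc (desW (b ∷ w))
    maj-eq rewrite ≥⇒<ᵇ-false {M} {a} (<⇒≤ a<M) | desW-∷∷ M b w | majW-∷∷ M b w | <⇒<ᵇ-true b<M = refl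
  later : map majTriple (map (a ∷_) (map (b ∷_) (insertions M w))) ≡
          map (prepended β (bit c)) (map majTriple (map (b ∷_) (insertions M w)))
  later = trans (sym (map-∘ (map (b ∷_) (insertions M w)))) (trans (sym (map-∘ (insertions M w)))
    (trans (map-cong-∈ _ _ (insertions M w) pointwise) (trans (map-∘ (insertions M w)) (map-∘ (map (b ∷_) (insertions M w))))))
    where
    pointwise : ∀ {y} → y ∈ insertions M w → majTriple (a ∷ b ∷ y) ≡ prepended β (bit c) (majTriple (b ∷ y))
    pointwise {y} y∈ = trans (majTriple-∷∷ a b y)
      (triple-≡ (cong (λ z → bit ((a <ᵇ b) ∧ z) + rlminW (b ∷ y)) a-below) refl refl)
      where
      a-below : allB (a <ᵇ_) y ≡ allB (a <ᵇ_) w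
      a-below rewrite allB-insertions (a <ᵇ_) M w y∈ | <⇒<ᵇ-true a<M = refl

insertions-triples : ∀ M w → All (_< M) w → map majTriple (insertions M w) ↭ successors (length w) (majTriple w)
insertions-triples M [] [] = ↭-refl
insertions-triples M (a ∷ w) (a<M ∷ w<M) = begin
  majTriple (M ∷ a ∷ w) ∷ map majTriple (map (a ∷_) (insertions M w))
    ↭⟨ prep _ (laterInsertions-triples M a w a<M w<M) ⟩
  majTriple (M ∷ a ∷ w) ∷ laterSuccessors (r , d , m) (length w ∸ d)
    ≡⟨ cong (_∷ laterSuccessors (r , d , m) (length w ∸ d)) front ⟩
  (r , suc d , m + suc d) ∷ laterSuccessors (r , d , m) (length w ∸ d)
    ↭⟨ rotate _ _ _ _ ⟩
  (suc r , d , m) ∷ raises (r , d , m) (countFrom 1 d) ++ raises (r , suc d , m) (countFrom (suc d) (suc (length w ∸ d)))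
    ≡⟨ cong (λ k → (suc r , d , m) ∷ raises (r , d , m) (countFrom 1 d) ++ raises (r , suc d , m) (countFrom (suc d) k))
            (+-∸-assoc 1 (desW≤length a w)) ⟨
  successors (length (a ∷ w)) (r , d , m) ∎
  where
  open PermutationReasoning
  r d m : ℕ
  r = rlminW (a ∷ w)
  d = desW (a ∷ w)
  m = majW (a ∷ w)
  front : majTriple (M ∷ a ∷ w) ≡ (r , suc d , m + suc d)
  front = trans (majTriple-∷∷ M a w) (triple-≡ rlmin-eq des-eq maj-eq)
    where
    rlmin-eq : bit (allB (M <ᵇ_) (a ∷ w)) + r ≡ r
    rlmin-eq rewrite ≥⇒<ᵇ-false {M} {a} (<⇒≤ a<M) = refl
    des-eq : bit (a <ᵇ M) + d ≡ suc d
    des-eq rewrite <⇒<ᵇ-true a<M = refl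
    maj-eq : bit (a <ᵇ M) + (m + d) ≡ m + suc d
    maj-eq rewrite <⇒<ᵇ-true a<M = sym (+-suc m d)

upTo≡countFrom : ∀ n → upTo n ≡ countFrom 0 n
upTo≡countFrom zero = refl
upTo≡countFrom (suc n) = cong (0 ∷_) (trans (sym (map-upTo suc n)) (trans (cong (map suc) (upTo≡countFrom n)) (map-suc 0 n)))
  where
  map-suc : ∀ s k → map suc (countFrom s k) ≡ countFrom (suc s) k
  map-suc s zero = refl
  map-suc s (suc k) = cong (suc s ∷_) (map-suc (suc s) k)

countFrom-+ : ∀ s a b → countFrom s (a + b) ≡ countFrom s a ++ countFrom (s + a) b
countFrom-+ s zero b = cong (λ t → countFrom t b) (sym (+-identityʳ s))
countFrom-+ s (suc a) b =
  cong (s ∷_) (trans (countFrom-+ (suc s) a b) (cong (λ t → countFrom (suc s) a ++ countFrom t b) (sym (+-suc s a))))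

∈-countFrom⁻ : ∀ s k {x} → x ∈ countFrom s k → s ≤ x × x < s + k
∈-countFrom⁻ s (suc k) (here refl) = ≤-refl , m<m+n s (s≤s z≤n)
∈-countFrom⁻ s (suc k) {x} (there x∈) with ∈-countFrom⁻ (suc s) k x∈
... | s<x , x< = <⇒≤ s<x , subst (x <_) (sym (+-suc s k)) x<

map-step≡successors : ∀ n r d m → d ≤ n → map (step (r , d , m)) (upTo (suc n)) ≡ successors n (r , d , m)
map-step≡successors n r d m d≤n = begin
  map (step (r , d , m)) (upTo (suc n))
    ≡⟨ cong (map (step (r , d , m))) (upTo≡countFrom (suc n)) ⟩
  (suc r , d , m) ∷ map (step (r , d , m)) (countFrom 1 n)
    ≡⟨ cong (λ k → (suc r , d , m) ∷ map (step (r , d , m)) (countFrom 1 k)) (sym (m+[n∸m]≡n d≤n)) ⟩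
  (suc r , d , m) ∷ map (step (r , d , m)) (countFrom 1 (d + (n ∸ d)))
    ≡⟨ cong (λ xs → (suc r , d , m) ∷ map (step (r , d , m)) xs) (countFrom-+ 1 d (n ∸ d)) ⟩
  (suc r , d , m) ∷ map (step (r , d , m)) (countFrom 1 d ++ countFrom (suc d) (n ∸ d))
    ≡⟨ cong ((suc r , d , m) ∷_) (map-++ (step (r , d , m)) (countFrom 1 d) (countFrom (suc d) (n ∸ d))) ⟩
  (suc r , d , m) ∷ map (step (r , d , m)) (countFrom 1 d) ++ map (step (r , d , m)) (countFrom (suc d) (n ∸ d))
    ≡⟨ cong ((suc r , d , m) ∷_) (cong₂ _++_ (map-cong-∈ _ _ (countFrom 1 d) no-new-descent)
                                              (map-cong-∈ _ _ (countFrom (suc d) (n ∸ d)) new-descent)) ⟩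
  successors n (r , d , m) ∎
  where
  open ≡-Reasoning
  no-new-descent : ∀ {x} → x ∈ countFrom 1 d → step (r , d , m) x ≡ (r , d , m + x)
  no-new-descent x∈ with ∈-countFrom⁻ 1 d x∈
  no-new-descent {suc u} x∈ | _ , s≤s x≤d rewrite ≥⇒<ᵇ-false {d} {suc u} x≤d = refl
  new-descent : ∀ {x} → x ∈ countFrom (suc d) (n ∸ d) → step (r , d , m) x ≡ (r , suc d , m + x)
  new-descent x∈ with ∈-countFrom⁻ (suc d) (n ∸ d) x∈
  new-descent {suc u} x∈ | d<x , _ rewrite <⇒<ᵇ-true {d} {suc u} d<x = refl

profile : ℕ → List Triple
profile zero = (0 , 0 , 0) ∷ []
profile (suc n) = concatMap (successors n) (profile n)

majTriples-perms : ∀ n → map majTriple (perms n) ↭ profile n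
majTriples-perms zero = ↭-refl
majTriples-perms (suc n) = begin
  map majTriple (concatMap (insertions (suc n)) (perms n))
    ≡⟨ map-concatMap majTriple (insertions (suc n)) (perms n) ⟩
  concatMap (map majTriple ∘ insertions (suc n)) (perms n)
    ↭⟨ concatMap-cong-↭ _ _ (perms n) insert-max ⟩
  concatMap (successors n ∘ majTriple) (perms n)
    ≡⟨ concatMap-map (successors n) majTriple (perms n) ⟨
  concatMap (successors n) (map majTriple (perms n))
    ↭⟨ concatMap-resp-↭ (successors n) (majTriples-perms n) ⟩
  profile (suc n) ∎
  where
  open PermutationReasoning
  insert-max : ∀ {w} → w ∈ perms n → map majTriple (insertions (suc n) w) ↭ successors n (majTriple w)
  insert-max {w} w∈ = subst (λ k → map majTriple (insertions (suc n) w) ↭ successors k (majTriple w))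
    (OnPermutation.length-w w n (perms-sound n w∈))
    (insertions-triples (suc n) w (All.tabulate (λ x∈ → s≤s (proj₂ (∈-oneTo⁻ n (∈-resp-↭ (perms-sound n w∈) x∈))))))

sorTriples-cycleInsertions : ∀ n {w} → w ↭ oneTo n → map (sorTriple (suc n)) (cycleInsertions n w) ≡ successors n (sorTriple n w)
sorTriples-cycleInsertions n {w} w↭ = begin
  map (sorTriple (suc n)) (map (insertInCycle n w) (upTo (suc n)))
    ≡⟨ map-∘ (upTo (suc n)) ⟨
  map (sorTriple (suc n) ∘ insertInCycle n w) (upTo (suc n))
    ≡⟨ map-cong-∈ _ _ (upTo (suc n)) (λ v∈ → sorTriple-insertInCycle n w _ (≤-pred (∈-upTo⁻ v∈)) w↭) ⟩
  map (step (sorTriple n w)) (upTo (suc n))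
    ≡⟨ map-step≡successors n _ _ _ st≤n ⟩
  successors n (sorTriple n w) ∎
  where
  open ≡-Reasoning
  st≤n : st (sorCode n w) ≤ n
  st≤n = subst (st (sorCode n w) ≤_) (trans (length-map _ (oneTo n)) (length-oneTo n)) (st≤length (sorCode n w))

sorTriples-perms : ∀ n → map (sorTriple n) (perms n) ↭ profile n
sorTriples-perms zero = ↭-refl
sorTriples-perms (suc n) = begin
  map (sorTriple (suc n)) (perms (suc n))
    ↭⟨ map⁺ (sorTriple (suc n)) (perms-suc↭cycleInsertions n) ⟩
  map (sorTriple (suc n)) (concatMap (cycleInsertions n) (perms n))
    ≡⟨ map-concatMap (sorTriple (suc n)) (cycleInsertions n) (perms n) ⟩
  concatMap (map (sorTriple (suc n)) ∘ cycleInsertions n) (perms n)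
    ≡⟨ concatMap-cong-∈ _ _ (perms n) (sorTriples-cycleInsertions n ∘ perms-sound n) ⟩
  concatMap (successors n ∘ sorTriple n) (perms n)
    ≡⟨ concatMap-map (successors n) (sorTriple n) (perms n) ⟨
  concatMap (successors n) (map (sorTriple n) (perms n))
    ↭⟨ concatMap-resp-↭ (successors n) (sorTriples-perms n) ⟩
  profile (suc n) ∎
  where
  open PermutationReasoning

triples-Sym-↭ : ∀ n → map (sorTriple n ∘ word) (Sym n) ↭ map (majTriple ∘ word) (Sym n)
triples-Sym-↭ n = begin
  map (sorTriple n ∘ word) (Sym n)         ≡⟨ map-∘ (Sym n) ⟩
  map (sorTriple n) (map word (Sym n))     ↭⟨ map⁺ (sorTriple n) (Sym↭perms n) ⟩
  map (sorTriple n) (perms n)              ↭⟨ sorTriples-perms n ⟩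
  profile n                                ↭⟨ majTriples-perms n ⟨
  map majTriple (perms n)                  ↭⟨ map⁺ majTriple (Sym↭perms n) ⟨
  map majTriple (map word (Sym n))         ≡⟨ map-∘ (Sym n) ⟨
  map (majTriple ∘ word) (Sym n)           ∎
  where open PermutationReasoning

mainTheorem6 : StirlingEulerMahonian cyc stSOR sor
mainTheorem6 n _ a b c = begin
  countB (is-abc ∘ sorTriple n ∘ word) (Sym n)      ≡⟨ countB-map is-abc (sorTriple n ∘ word) (Sym n) ⟩
  countB is-abc (map (sorTriple n ∘ word) (Sym n))  ≡⟨ countB-resp-↭ is-abc (triples-Sym-↭ n) ⟩
  countB is-abc (map (majTriple ∘ word) (Sym n))    ≡⟨ countB-map is-abc (majTriple ∘ word) (Sym n) ⟨
  countB (is-abc ∘ majTriple ∘ word) (Sym n)        ∎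
  where
  open ≡-Reasoning
  is-abc : Triple → Bool
  is-abc (r , d , m) = (r ≡ᵇ a) ∧ (d ≡ᵇ b) ∧ (m ≡ᵇ c)
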